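{- Let $D$ be an $\mathrm{STS}_2(v)$ on $V=\mathbb{F}_2^v$ with an automorphism of type $A_{v,1}$. Then $D$ contains $\frac{2^{v-1}-1}{3}$ fixed blocks of type $1$, and the remaining blocks of $D$ are partitioned into orbits of length $3$ (under the group generated by this automorphism). Furthermore, $V$ can be represented as $V=W+X$ with $\mathbb{F}_2$-vector spaces $W$ and $X$ of dimension $v-1$ and $1$, respectively, such that the fixed blocks of type $1$ are given by the set $\{L+X : L\in\mathcal{L}\}$, where $\mathcal{L}$ is a Desarguesian line spread of $\mathrm{PG}(W)$.
   Context: An $\mathrm{STS}_2(v)$ on $V=\mathbb{F}_2^v$ is a set of $3$-dimensional subspaces (blocks) of $V$ such that every $2$-dimensional subspace lies in exactly one block. $\mathrm{GL}(v,2)$ acts on subspaces via $\mathbf{x}\mapsto\mathbf{x}A$; an automorphism of $D$ is an $A\in\mathrm{GL}(v,2)$ mapping $D$ to itself. $A_{v,1}$ is the block-diagonal matrix consisting of $\frac{v-1}{2}$ blocks $\begin{pmatrix}0&1\\1&1\end{pmatrix}$ followed by $I_1$; an element of order $3$ has type $A_{v,1}$ if it is conjugate to $A_{v,1}$. A block fixed by the automorphism is of type $1$ if the automorphism acts nontrivially (with order $3$) on it. A Desarguesian line spread of $\mathrm{PG}(W)$, $W\cong\mathbb{F}_2^{v-1}$ with $v-1$ even, is the set of $2$-dimensional $\mathbb{F}_2$-subspaces of $W$ arising as the $1$-dimensional $\mathbb{F}_4$-subspaces under an identification $W\cong\mathbb{F}_4^{(v-1)/2}$. -}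

module Defs where

open import Level using (0ℓ)
open import Data.Bool using (Bool; true; false; _∧_; not; _xor_; if_then_else_)
open import Data.Nat using (ℕ; zero; suc; _+_; _≡ᵇ_; _<ᵇ_; _%_; ⌊_/2⌋)
open import Data.Fin using (Fin; toℕ; _≟_)
open import Data.Vec using (Vec; []; _∷_; lookup; tabulate; zipWith; replicate; foldr; map)
open import Data.Product using (Σ; ∃; ∃-syntax; _×_; _,_)
open import Data.List using (List; length)
open import Data.List.Relation.Unary.Any using (Any)
open import Data.List.Relation.Unary.All using (All)
open import Data.List.Relation.Unary.AllPairs using (AllPairs)
open import Relation.Binary.PropositionalEquality using (_≡_)
open import Relation.Nullary using (¬_)
open import Relation.Nullary.Decidable using (⌊_⌋)
open import Function.Bundles using (_⇔_)

Vecₙ : ℕ → Set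
Vecₙ n = Vec Bool n

_⊕_ : ∀ {n} → Vecₙ n → Vecₙ n → Vecₙ n
_⊕_ = zipWith _xor_

𝟎 : ∀ {n} → Vecₙ n
𝟎 = replicate _ false

comb : ∀ {n k} → Vec Bool k → Vec (Vecₙ n) k → Vecₙ n
comb []       []       = 𝟎
comb (c ∷ cs) (b ∷ bs) = if c then b ⊕ comb cs bs else comb cs bs

LinIndep : ∀ {n k} → Vec (Vecₙ n) k → Set
LinIndep {n} {k} b = ∀ (c : Vec Bool k) → comb c b ≡ 𝟎 → c ≡ replicate _ false

Sub : ℕ → Set₁
Sub n = Vecₙ n → Set

_≐_ : ∀ {n} → Sub n → Sub n → Set
S ≐ T = ∀ y → S y ⇔ T y

_⊆_ : ∀ {n} → Sub n → Sub n → Set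
S ⊆ T = ∀ y → S y → T y

IsSubspaceOfDim : ∀ {n} → ℕ → Sub n → Set
IsSubspaceOfDim {n} k S =
  Σ (Vec (Vecₙ n) k) λ b → LinIndep b × (∀ y → S y ⇔ (∃[ c ] comb c b ≡ y))

_+ˢ_ : ∀ {n} → Sub n → Sub n → Sub n
(S +ˢ T) y = ∃[ s ] ∃[ t ] (S s × T t × s ⊕ t ≡ y)

Mat : ℕ → Set
Mat n = Fin n → Fin n → Bool

⊕sum : ∀ {n} → Vec Bool n → Bool
⊕sum = foldr _ _xor_ false

_⋆_ : ∀ {n} → Vecₙ n → Mat n → Vecₙ n
x ⋆ A = tabulate λ j → ⊕sum (tabulate λ i → lookup x i ∧ A i j)

_·_ : ∀ {n} → Mat n → Mat n → Mat n
(A · B) i j = ⊕sum (tabulate λ k → A i k ∧ B k j)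

Id : ∀ {n} → Mat n
Id i j = ⌊ i ≟ j ⌋

_≈ₘ_ : ∀ {n} → Mat n → Mat n → Set
A ≈ₘ B = ∀ i j → A i j ≡ B i j

InGL : ∀ {n} → Mat n → Set
InGL {n} A = ∃[ B ] ((A · B) ≈ₘ Id × (B · A) ≈ₘ Id)

Conjugate : ∀ {n} → Mat n → Mat n → Set
Conjugate {n} A C =
  ∃[ P ] ∃[ Q ] ((P · Q) ≈ₘ Id × (Q · P) ≈ₘ Id × A ≈ₘ ((Q · C) · P))

-- A_{v,1} for v = 2m+1 : m blocks [[0,1],[1,1]] followed by I₁.
-- Entry (a,b): nonzero iff a,b are in the same diagonal block, except the
-- (0,0)-entry of each 2×2 block.
A-v1 : (m : ℕ) → Mat (suc (m + m))
A-v1 m i j =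
  (⌊ a /2⌋ ≡ᵇ ⌊ b /2⌋) ∧ not ((a ≡ᵇ b) ∧ ((a % 2 ≡ᵇ 0) ∧ (a <ᵇ m + m)))
  where
  a = toℕ i
  b = toℕ j

img : ∀ {n} → Mat n → Sub n → Sub n
img A S y = ∃[ x ] (S x × x ⋆ A ≡ y)

-- Designs: a finite set of blocks, given as a duplicate-free list

Design : ℕ → Set₁
Design n = List (Sub n)

_∈ᴰ_ : ∀ {n} → Sub n → Design n → Set₁
B ∈ᴰ D = Any (λ B′ → B′ ≐ B) D

IsSTS₂ : (n : ℕ) → Design n → Set₁
IsSTS₂ n D =
  All (IsSubspaceOfDim 3) D ×
  AllPairs (λ B B′ → ¬ (B ≐ B′)) D ×
  (∀ (T : Sub n) → IsSubspaceOfDim 2 T →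
     (Σ (Sub n) λ B → B ∈ᴰ D × T ⊆ B) ×
     (∀ B B′ → B ∈ᴰ D → B′ ∈ᴰ D → T ⊆ B → T ⊆ B′ → B ≐ B′))

IsAutomorphism : ∀ {n} → Mat n → Design n → Set₁
IsAutomorphism {n} A D =
  InGL A ×
  (∀ B → B ∈ᴰ D → img A B ∈ᴰ D) ×
  (∀ B → B ∈ᴰ D → Σ (Sub n) λ B′ → B′ ∈ᴰ D × img A B′ ≐ B)

FixedType1 : ∀ {n} → Mat n → Sub n → Set
FixedType1 A B = img A B ≐ B × ∃[ x ] (B x × ¬ (x ⋆ A ≡ x))

-- The field F₄ = {a + bω}, ω² = ω + 1, encoded as pairs (a , b)

F4 : Set
F4 = Bool × Bool

_*₄_ : F4 → F4 → F4
(a , b) *₄ (c , d) = ((a ∧ c) xor (b ∧ d)) , ((a ∧ d) xor (b ∧ c)) xor (b ∧ d)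

_+₄_ : F4 → F4 → F4
(a , b) +₄ (c , d) = (a xor c) , (b xor d)

F4span : ∀ {m} → Vec F4 m → Vec F4 m → Set
F4span u w = ∃[ λ₀ ] map (λ₀ *₄_) u ≡ w

IsDesarguesianSpread : ∀ {n} (m : ℕ) → Sub n → (Sub n → Set) → Set₁
IsDesarguesianSpread {n} m W 𝓛 =
  Σ (Vec F4 m → Vecₙ n) λ φ →
    (∀ u w → φ (zipWith _+₄_ u w) ≡ φ u ⊕ φ w) ×
    (∀ u w → φ u ≡ φ w → u ≡ w) ×
    (∀ y → W y ⇔ (∃[ u ] φ u ≡ y)) ×
    (∀ L → 𝓛 L ⇔ (∃[ u ] (¬ (u ≡ replicate _ (false , false)) × L ≐ img′ φ u)))
  where
  img′ : (Vec F4 m → Vecₙ n) → Vec F4 m → Sub n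
  img′ φ u y = ∃[ w ] (F4span u w × φ w ≡ y)

-- Conjugating by P, where A = Q A_{v,1} P and P Q = 1, identifies V = F₂^(2m+1) with F₄ᵐ × F₂
-- so that x ↦ x A becomes (u , t) ↦ (ω u , t). Hence A has order 3 and fixes only 0 and
-- x₀ = (0 , 1). Every F₄-line ℓ of W = F₄ᵐ × 0 is an A-invariant 2-space, so the block
-- through ℓ is A-invariant; a 3-space invariant under an element of order 3 contains a
-- nonzero fixed vector, here x₀, so that block is ℓ + ⟨x₀⟩, a fixed block of type 1.
-- Conversely a fixed block of type 1 contains x + x A for a moved point x, hence the
-- F₄-line through it. So these blocks correspond to the (4ᵐ − 1)/3 points of PG(m − 1, 4).
-- A fixed block not of type 1 would consist of fixed points of A, impossible inside
-- {0 , x₀}; as A³ = 1, all other orbits have length 3.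

module Submission where

open import Defs

open import Algebra.Bundles using (CommutativeRing)
open import Data.Bool using (Bool; true; false; T; _∧_; _∨_; not; _xor_)
open import Data.Bool.Properties
  using ( xor-assoc; xor-comm; xor-identityˡ; xor-identityʳ; xor-same; xor-∧-commutativeRing
        ; ∧-assoc; ∧-zeroʳ; ∧-identityʳ; ∧-distribˡ-xor; ∧-distribʳ-xor; T-∧; T-∨ )
  renaming (_≟_ to _≟ᵇ_)
open import Algebra.Properties.CommutativeSemigroup
  (CommutativeRing.+-commutativeSemigroup xor-∧-commutativeRing) using () renaming (interchange to xor-interchange)
open import Data.Empty using (⊥-elim)
open import Data.Fin using (Fin; toℕ; _≟_) renaming (zero to fzero; suc to fsuc)
open import Data.Fin.Properties using (toℕ<n)
import Data.List as List
open import Data.List using (List; length; cartesianProductWith)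
  renaming ([] to []ᴸ; _∷_ to _∷ᴸ_; _++_ to _++ᴸ_)
open import Data.List.Properties using (length-++; length-map)
open import Data.List.Membership.Propositional using (_∈_)
open import Data.List.Relation.Unary.All using (All) renaming ([] to []ᴬ; _∷_ to _∷ᴬ_)
import Data.List.Relation.Unary.All as All
import Data.List.Relation.Unary.All.Properties as All
open import Data.List.Relation.Unary.AllPairs using (AllPairs) renaming ([] to []ᴾ; _∷_ to _∷ᴾ_)
import Data.List.Relation.Unary.AllPairs as AllPairs
import Data.List.Relation.Unary.AllPairs.Properties as AllPairs
open import Data.List.Relation.Unary.Any using (Any; here; there)
import Data.List.Relation.Unary.Any as Any
import Data.List.Relation.Unary.Any.Properties as Any
open import Data.List.Relation.Unary.Unique.Propositional using (Unique)
import Data.List.Relation.Unary.Unique.Propositional.Properties as Unique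
open import Data.Nat using (ℕ; zero; suc; _+_; _*_; _^_; _∸_; _/_; _<_; _≡ᵇ_; _<ᵇ_; _%_; ⌊_/2⌋; s≤s)
open import Data.Nat.DivMod using (m*n/n≡m)
open import Data.Nat.Properties using (+-suc; suc-injective; *-assoc; *-comm; m+n∸n≡m)
open import Data.Nat.Tactic.RingSolver using (solve-∀)
open import Data.Product using (Σ; ∃-syntax; _×_; _,_; proj₁; proj₂; uncurry)
open import Data.Product.Properties using (×-≡,≡←≡) renaming (≡-dec to ×-≡-dec)
open import Data.Sum using (_⊎_; inj₁; inj₂; [_,_]′)
open import Data.Unit using (tt)
open import Data.Vec
  using (Vec; []; _∷_; lookup; tabulate; zipWith; zip; unzip; replicate; map; _++_; take; drop; toList)
open import Data.Vec.Properties
  using ( ≡-dec; ∷-injective; ∷-injectiveˡ; ∷-injectiveʳ; map-∘; map-cong; map-id; map-const; length-toList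
        ; take-zipWith; drop-zipWith; take++drop≡id; unzip∘zip; ++-injective; zipWith-assoc; zipWith-comm
        ; zipWith-identityˡ; zipWith-identityʳ; lookup∘tabulate; tabulate∘lookup; tabulate-cong
        ; lookup-zipWith )
open import Data.Vec.Relation.Unary.All as Allⱽ using ([]; _∷_) renaming (All to Allⱽ)
import Data.Vec.Relation.Unary.All.Properties as Allⱽ
open import Function using (id; _∘_; case_of_)
open import Function.Bundles using (_⇔_; mk⇔; Equivalence)
import Function.Properties.Equivalence as ⇔
open import Relation.Binary.PropositionalEquality
open import Relation.Nullary using (¬_; Dec; yes; no; contradiction)
open import Relation.Nullary.Decidable
  using (⌊_⌋; ⌊⌋-map′; True; toWitness; toWitnessFalse; map′; ¬?; _×-dec_; _→-dec_)

open ≡-Reasoning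

private
  variable
    m n k j : ℕ

⊕-assoc : (x y z : Vecₙ n) → (x ⊕ y) ⊕ z ≡ x ⊕ (y ⊕ z)
⊕-assoc = zipWith-assoc xor-assoc

⊕-comm : (x y : Vecₙ n) → x ⊕ y ≡ y ⊕ x
⊕-comm = zipWith-comm xor-comm

⊕-identityˡ : (x : Vecₙ n) → 𝟎 ⊕ x ≡ x
⊕-identityˡ = zipWith-identityˡ xor-identityˡ

⊕-identityʳ : (x : Vecₙ n) → x ⊕ 𝟎 ≡ x
⊕-identityʳ = zipWith-identityʳ xor-identityʳ

⊕-self : (x : Vecₙ n) → x ⊕ x ≡ 𝟎
⊕-self []      = refl
⊕-self (a ∷ x) = cong₂ _∷_ (xor-same a) (⊕-self x)

⊕≡𝟎⇒≡ : (x y : Vecₙ n) → x ⊕ y ≡ 𝟎 → x ≡ y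
⊕≡𝟎⇒≡ x y x⊕y≡𝟎 = begin
  x            ≡⟨ ⊕-identityʳ x ⟨
  x ⊕ 𝟎        ≡⟨ cong (x ⊕_) (⊕-self y) ⟨
  x ⊕ (y ⊕ y)  ≡⟨ ⊕-assoc x y y ⟨
  (x ⊕ y) ⊕ y  ≡⟨ cong (_⊕ y) x⊕y≡𝟎 ⟩
  𝟎 ⊕ y        ≡⟨ ⊕-identityˡ y ⟩
  y            ∎

⊕-interchange : (a b c d : Vecₙ n) → (a ⊕ b) ⊕ (c ⊕ d) ≡ (a ⊕ c) ⊕ (b ⊕ d)
⊕-interchange a b c d = begin
  (a ⊕ b) ⊕ (c ⊕ d)  ≡⟨ ⊕-assoc a b (c ⊕ d) ⟩
  a ⊕ (b ⊕ (c ⊕ d))  ≡⟨ cong (a ⊕_) (⊕-assoc b c d) ⟨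
  a ⊕ ((b ⊕ c) ⊕ d)  ≡⟨ cong (λ z → a ⊕ (z ⊕ d)) (⊕-comm b c) ⟩
  a ⊕ ((c ⊕ b) ⊕ d)  ≡⟨ cong (a ⊕_) (⊕-assoc c b d) ⟩
  a ⊕ (c ⊕ (b ⊕ d))  ≡⟨ ⊕-assoc a c (b ⊕ d) ⟨
  (a ⊕ c) ⊕ (b ⊕ d)  ∎

_≟ⱽ_ : (x y : Vecₙ n) → Dec (x ≡ y)
_≟ⱽ_ = ≡-dec _≟ᵇ_

≗-lookup⇒≡ : {A : Set} (u v : Vec A n) → (∀ i → lookup u i ≡ lookup v i) → u ≡ v
≗-lookup⇒≡ u v u≗v = begin
  u                  ≡⟨ tabulate∘lookup u ⟨
  tabulate (lookup u) ≡⟨ tabulate-cong u≗v ⟩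
  tabulate (lookup v) ≡⟨ tabulate∘lookup v ⟩
  v                  ∎

⊕Σ : (Fin n → Bool) → Bool
⊕Σ {zero}  F = false
⊕Σ {suc n} F = F fzero xor ⊕Σ (λ i → F (fsuc i))

⊕sum-tabulate : (F : Fin n → Bool) → ⊕sum (tabulate F) ≡ ⊕Σ F
⊕sum-tabulate {zero}  F = refl
⊕sum-tabulate {suc n} F = cong (F fzero xor_) (⊕sum-tabulate (λ i → F (fsuc i)))

⊕Σ-cong : {F G : Fin n → Bool} → (∀ i → F i ≡ G i) → ⊕Σ F ≡ ⊕Σ G
⊕Σ-cong {zero}  F≗G = refl
⊕Σ-cong {suc n} F≗G = cong₂ _xor_ (F≗G fzero) (⊕Σ-cong (λ i → F≗G (fsuc i)))

⊕Σ-false : ∀ n → ⊕Σ {n} (λ _ → false) ≡ false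
⊕Σ-false zero    = refl
⊕Σ-false (suc n) = ⊕Σ-false n

⊕Σ-xor : (F G : Fin n → Bool) → ⊕Σ (λ i → F i xor G i) ≡ ⊕Σ F xor ⊕Σ G
⊕Σ-xor {zero}  F G = refl
⊕Σ-xor {suc n} F G = begin
  (F fzero xor G fzero) xor ⊕Σ (λ i → F (fsuc i) xor G (fsuc i))
    ≡⟨ cong ((F fzero xor G fzero) xor_) (⊕Σ-xor (λ i → F (fsuc i)) (λ i → G (fsuc i))) ⟩
  (F fzero xor G fzero) xor (⊕Σ (λ i → F (fsuc i)) xor ⊕Σ (λ i → G (fsuc i)))
    ≡⟨ xor-interchange (F fzero) (G fzero) _ _ ⟩
  (F fzero xor ⊕Σ (λ i → F (fsuc i))) xor (G fzero xor ⊕Σ (λ i → G (fsuc i))) ∎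

∧-⊕Σ : (a : Bool) (F : Fin n → Bool) → a ∧ ⊕Σ F ≡ ⊕Σ (λ i → a ∧ F i)
∧-⊕Σ {zero}  a F = ∧-zeroʳ a
∧-⊕Σ {suc n} a F = trans (∧-distribˡ-xor a (F fzero) _) (cong ((a ∧ F fzero) xor_) (∧-⊕Σ a (λ i → F (fsuc i))))

⊕Σ-∧ : (a : Bool) (F : Fin n → Bool) → ⊕Σ F ∧ a ≡ ⊕Σ (λ i → F i ∧ a)
⊕Σ-∧ {zero}  a F = refl
⊕Σ-∧ {suc n} a F = trans (∧-distribʳ-xor a (F fzero) _) (cong ((F fzero ∧ a) xor_) (⊕Σ-∧ a (λ i → F (fsuc i))))

⊕Σ-comm : (F : Fin n → Fin k → Bool) → ⊕Σ (λ i → ⊕Σ (F i)) ≡ ⊕Σ (λ j → ⊕Σ (λ i → F i j))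
⊕Σ-comm {zero} {k} F = sym (⊕Σ-false k)
⊕Σ-comm {suc n} F = begin
  ⊕Σ (F fzero) xor ⊕Σ (λ i → ⊕Σ (F (fsuc i)))
    ≡⟨ cong (⊕Σ (F fzero) xor_) (⊕Σ-comm (λ i → F (fsuc i))) ⟩
  ⊕Σ (F fzero) xor ⊕Σ (λ j → ⊕Σ (λ i → F (fsuc i) j))
    ≡⟨ ⊕Σ-xor (F fzero) _ ⟨
  ⊕Σ (λ j → F fzero j xor ⊕Σ (λ i → F (fsuc i) j)) ∎

⊕Σ-indicator : (F : Fin n → Bool) (j : Fin n) → ⊕Σ (λ i → F i ∧ ⌊ i ≟ j ⌋) ≡ F j
⊕Σ-indicator {suc n} F fzero = begin
  (F fzero ∧ true) xor ⊕Σ (λ i → F (fsuc i) ∧ false)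
    ≡⟨ cong₂ _xor_ (∧-identityʳ (F fzero)) (trans (⊕Σ-cong (λ i → ∧-zeroʳ (F (fsuc i)))) (⊕Σ-false n)) ⟩
  F fzero xor false ≡⟨ xor-identityʳ (F fzero) ⟩
  F fzero           ∎
⊕Σ-indicator F (fsuc j) = begin
  (F fzero ∧ false) xor ⊕Σ (λ i → F (fsuc i) ∧ ⌊ fsuc i ≟ fsuc j ⌋)
    ≡⟨ cong₂ _xor_ (∧-zeroʳ (F fzero)) (⊕Σ-cong λ i → cong (F (fsuc i) ∧_) (⌊⌋-map′ _ _ (i ≟ j))) ⟩
  ⊕Σ (λ i → F (fsuc i) ∧ ⌊ i ≟ j ⌋)
    ≡⟨ ⊕Σ-indicator (λ i → F (fsuc i)) j ⟩
  F (fsuc j) ∎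

lookup-⋆ : (x : Vecₙ n) (M : Mat n) (j : Fin n) → lookup (x ⋆ M) j ≡ ⊕Σ (λ i → lookup x i ∧ M i j)
lookup-⋆ x M j = trans (lookup∘tabulate _ j) (⊕sum-tabulate (λ i → lookup x i ∧ M i j))

·-entry : (M N : Mat n) (i j : Fin n) → (M · N) i j ≡ ⊕Σ (λ k → M i k ∧ N k j)
·-entry M N i j = ⊕sum-tabulate (λ k → M i k ∧ N k j)

⋆-⊕ : (x y : Vecₙ n) (M : Mat n) → (x ⊕ y) ⋆ M ≡ (x ⋆ M) ⊕ (y ⋆ M)
⋆-⊕ {n} x y M = ≗-lookup⇒≡ _ _ λ j → begin
  lookup ((x ⊕ y) ⋆ M) j
    ≡⟨ lookup-⋆ (x ⊕ y) M j ⟩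
  ⊕Σ (λ i → lookup (x ⊕ y) i ∧ M i j)
    ≡⟨ ⊕Σ-cong (λ i → trans (cong (_∧ M i j) (lookup-zipWith _xor_ i x y)) (∧-distribʳ-xor (M i j) (lookup x i) (lookup y i))) ⟩
  ⊕Σ (λ i → (lookup x i ∧ M i j) xor (lookup y i ∧ M i j))
    ≡⟨ ⊕Σ-xor {n} _ _ ⟩
  ⊕Σ (λ i → lookup x i ∧ M i j) xor ⊕Σ (λ i → lookup y i ∧ M i j)
    ≡⟨ cong₂ _xor_ (lookup-⋆ x M j) (lookup-⋆ y M j) ⟨
  lookup (x ⋆ M) j xor lookup (y ⋆ M) j
    ≡⟨ lookup-zipWith _xor_ j (x ⋆ M) (y ⋆ M) ⟨
  lookup ((x ⋆ M) ⊕ (y ⋆ M)) j ∎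

⋆-Id : (x : Vecₙ n) → x ⋆ Id ≡ x
⋆-Id x = ≗-lookup⇒≡ _ _ λ j → trans (lookup-⋆ x Id j) (⊕Σ-indicator (lookup x) j)

⋆-cong : (x : Vecₙ n) {M N : Mat n} → M ≈ₘ N → x ⋆ M ≡ x ⋆ N
⋆-cong x M≈N = tabulate-cong λ j → cong ⊕sum (tabulate-cong λ i → cong (lookup x i ∧_) (M≈N i j))

⋆-· : (x : Vecₙ n) (M N : Mat n) → x ⋆ (M · N) ≡ (x ⋆ M) ⋆ N
⋆-· {n} x M N = ≗-lookup⇒≡ _ _ λ j → begin
  lookup (x ⋆ (M · N)) j
    ≡⟨ lookup-⋆ x (M · N) j ⟩
  ⊕Σ (λ i → lookup x i ∧ (M · N) i j)
    ≡⟨ ⊕Σ-cong (λ i → trans (cong (lookup x i ∧_) (·-entry M N i j)) (∧-⊕Σ {n} (lookup x i) _)) ⟩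
  ⊕Σ (λ i → ⊕Σ (λ k → lookup x i ∧ (M i k ∧ N k j)))
    ≡⟨ ⊕Σ-comm {n} {n} _ ⟩
  ⊕Σ (λ k → ⊕Σ (λ i → lookup x i ∧ (M i k ∧ N k j)))
    ≡⟨ ⊕Σ-cong (λ k → trans (⊕Σ-cong (λ i → sym (∧-assoc (lookup x i) (M i k) (N k j)))) (sym (⊕Σ-∧ {n} (N k j) _))) ⟩
  ⊕Σ (λ k → ⊕Σ (λ i → lookup x i ∧ M i k) ∧ N k j)
    ≡⟨ ⊕Σ-cong (λ k → cong (_∧ N k j) (lookup-⋆ x M k)) ⟨
  ⊕Σ (λ k → lookup (x ⋆ M) k ∧ N k j)
    ≡⟨ lookup-⋆ (x ⋆ M) N j ⟨
  lookup ((x ⋆ M) ⋆ N) j ∎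

⋆-inverse : (M N : Mat n) → (M · N) ≈ₘ Id → ∀ z → (z ⋆ M) ⋆ N ≡ z
⋆-inverse M N MN≈Id z = trans (sym (⋆-· z M N)) (trans (⋆-cong z MN≈Id) (⋆-Id z))

Span : Vec (Vecₙ n) k → Sub n
Span b y = ∃[ c ] comb c b ≡ y

Additive : (Vecₙ k → Vecₙ n) → Set
Additive g = ∀ x y → g (x ⊕ y) ≡ g x ⊕ g y

additive-𝟎 : (g : Vecₙ k → Vecₙ n) → Additive g → g 𝟎 ≡ 𝟎
additive-𝟎 g g-⊕ = begin
  g 𝟎          ≡⟨ cong g (⊕-self 𝟎) ⟨
  g (𝟎 ⊕ 𝟎)    ≡⟨ g-⊕ 𝟎 𝟎 ⟩
  g 𝟎 ⊕ g 𝟎    ≡⟨ ⊕-self (g 𝟎) ⟩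
  𝟎            ∎

comb-𝟎 : (b : Vec (Vecₙ n) k) → comb 𝟎 b ≡ 𝟎
comb-𝟎 []      = refl
comb-𝟎 (x ∷ b) = comb-𝟎 b

comb-⊕ : (c d : Vecₙ k) (b : Vec (Vecₙ n) k) → comb (c ⊕ d) b ≡ comb c b ⊕ comb d b
comb-⊕ []          []          []      = sym (⊕-self 𝟎)
comb-⊕ (true ∷ c)  (true ∷ d)  (x ∷ b) = begin
  comb (c ⊕ d) b                    ≡⟨ comb-⊕ c d b ⟩
  comb c b ⊕ comb d b               ≡⟨ ⊕-identityˡ _ ⟨
  𝟎 ⊕ (comb c b ⊕ comb d b)         ≡⟨ cong (_⊕ _) (⊕-self x) ⟨
  (x ⊕ x) ⊕ (comb c b ⊕ comb d b)   ≡⟨ ⊕-interchange x x (comb c b) (comb d b) ⟩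
  (x ⊕ comb c b) ⊕ (x ⊕ comb d b)   ∎
comb-⊕ (true ∷ c)  (false ∷ d) (x ∷ b) = trans (cong (x ⊕_) (comb-⊕ c d b)) (sym (⊕-assoc x _ _))
comb-⊕ (false ∷ c) (true ∷ d)  (x ∷ b) = begin
  x ⊕ comb (c ⊕ d) b             ≡⟨ cong (x ⊕_) (comb-⊕ c d b) ⟩
  x ⊕ (comb c b ⊕ comb d b)      ≡⟨ ⊕-assoc x _ _ ⟨
  (x ⊕ comb c b) ⊕ comb d b      ≡⟨ cong (_⊕ comb d b) (⊕-comm x (comb c b)) ⟩
  (comb c b ⊕ x) ⊕ comb d b      ≡⟨ ⊕-assoc _ x _ ⟩
  comb c b ⊕ (x ⊕ comb d b)      ∎
comb-⊕ (false ∷ c) (false ∷ d) (x ∷ b) = comb-⊕ c d b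

comb-++ : (c : Vecₙ k) (d : Vecₙ j) (b : Vec (Vecₙ n) k) (b′ : Vec (Vecₙ n) j) →
  comb (c ++ d) (b ++ b′) ≡ comb c b ⊕ comb d b′
comb-++ []          d []      b′ = sym (⊕-identityˡ _)
comb-++ (true ∷ c)  d (x ∷ b) b′ = trans (cong (x ⊕_) (comb-++ c d b b′)) (sym (⊕-assoc x _ _))
comb-++ (false ∷ c) d (x ∷ b) b′ = comb-++ c d b b′

comb-map : (g : Vecₙ n → Vecₙ j) → Additive g →
  (c : Vecₙ k) (b : Vec (Vecₙ n) k) → g (comb c b) ≡ comb c (map g b)
comb-map g g-⊕ []          []      = additive-𝟎 g g-⊕
comb-map g g-⊕ (true ∷ c)  (x ∷ b) = trans (g-⊕ x (comb c b)) (cong (g x ⊕_) (comb-map g g-⊕ c b))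
comb-map g g-⊕ (false ∷ c) (x ∷ b) = comb-map g g-⊕ c b

comb-comb : (c : Vecₙ j) (rows : Vec (Vecₙ k) j) (b : Vec (Vecₙ n) k) →
  comb c (map (λ r → comb r b) rows) ≡ comb (comb c rows) b
comb-comb []          []         b = sym (comb-𝟎 b)
comb-comb (true ∷ c)  (r ∷ rows) b = trans (cong (comb r b ⊕_) (comb-comb c rows b)) (sym (comb-⊕ r (comb c rows) b))
comb-comb (false ∷ c) (r ∷ rows) b = comb-comb c rows b

comb-injective : (b : Vec (Vecₙ n) k) → LinIndep b → ∀ c d → comb c b ≡ comb d b → c ≡ d
comb-injective b indep c d c≡d = ⊕≡𝟎⇒≡ c d (indep (c ⊕ d) (begin
  comb (c ⊕ d) b        ≡⟨ comb-⊕ c d b ⟩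
  comb c b ⊕ comb d b   ≡⟨ cong (_⊕ comb d b) c≡d ⟩
  comb d b ⊕ comb d b   ≡⟨ ⊕-self _ ⟩
  𝟎                     ∎))

subspace-𝟎 : {S : Sub n} → IsSubspaceOfDim k S → S 𝟎
subspace-𝟎 (b , _ , S⇔Span) = Equivalence.from (S⇔Span 𝟎) (𝟎 , comb-𝟎 b)

subspace-⊕ : {S : Sub n} → IsSubspaceOfDim k S → ∀ {x y} → S x → S y → S (x ⊕ y)
subspace-⊕ (b , _ , S⇔Span) {x} {y} x∈S y∈S with Equivalence.to (S⇔Span x) x∈S | Equivalence.to (S⇔Span y) y∈S
... | c , refl | d , refl = Equivalence.from (S⇔Span _) (c ⊕ d , comb-⊕ c d b)

subspace-comb : {S : Sub n} → IsSubspaceOfDim k S →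
  {b : Vec (Vecₙ n) j} → Allⱽ S b → ∀ c → S (comb c b)
subspace-comb S-dim []             []          = subspace-𝟎 S-dim
subspace-comb S-dim (x∈S ∷ b⊆S)    (true ∷ c)  = subspace-⊕ S-dim x∈S (subspace-comb S-dim b⊆S c)
subspace-comb S-dim (x∈S ∷ b⊆S)    (false ∷ c) = subspace-comb S-dim b⊆S c

standardBasis : ∀ k → Vec (Vecₙ k) k
standardBasis zero    = []
standardBasis (suc k) = (true ∷ 𝟎) ∷ map (false ∷_) (standardBasis k)

comb-standardBasis : (c : Vecₙ k) → comb c (standardBasis k) ≡ c
comb-shift : (c : Vecₙ k) → comb c (map (false ∷_) (standardBasis k)) ≡ false ∷ c
comb-standardBasis []          = refl
comb-standardBasis (true ∷ c)  = begin
  (true ∷ 𝟎) ⊕ comb c (map (false ∷_) (standardBasis _))  ≡⟨ cong ((true ∷ 𝟎) ⊕_) (comb-shift c) ⟩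
  (true ∷ 𝟎) ⊕ (false ∷ c)                                ≡⟨ cong (true ∷_) (⊕-identityˡ c) ⟩
  true ∷ c                                                ∎
comb-standardBasis (false ∷ c) = comb-shift c

comb-shift c = trans (sym (comb-map (false ∷_) (λ _ _ → refl) c _)) (cong (false ∷_) (comb-standardBasis c))

image-dim : (g : Vecₙ k → Vecₙ n) → Additive g → (∀ c d → g c ≡ g d → c ≡ d) →
  IsSubspaceOfDim k (λ y → ∃[ c ] g c ≡ y)
image-dim {k} g g-⊕ g-injective = map g (standardBasis k) , indep , λ y → mk⇔
  (λ (c , gc≡y) → c , trans (comb-g c) gc≡y)
  (λ (c , c↦y) → c , trans (sym (comb-g c)) c↦y)
  where
  comb-g : ∀ c → comb c (map g (standardBasis k)) ≡ g c
  comb-g c = trans (sym (comb-map g g-⊕ c (standardBasis k))) (cong g (comb-standardBasis c))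
  indep : LinIndep (map g (standardBasis k))
  indep c c↦𝟎 = g-injective c 𝟎 (trans (sym (comb-g c)) (trans c↦𝟎 (sym (additive-𝟎 g g-⊕))))

-- Two facts about F₂³, checked by exhaustive evaluation

allⱽ anyⱽ : (Vecₙ n → Bool) → Bool
allⱽ {zero}  p = p []
allⱽ {suc n} p = allⱽ (λ v → p (false ∷ v)) ∧ allⱽ (λ v → p (true ∷ v))
anyⱽ {zero}  p = p []
anyⱽ {suc n} p = anyⱽ (λ v → p (false ∷ v)) ∨ anyⱽ (λ v → p (true ∷ v))

allⱽ-sound : (p : Vecₙ n → Bool) → T (allⱽ p) → ∀ v → T (p v)
allⱽ-sound {zero}  p all-p []      = all-p
allⱽ-sound {suc n} p all-p (a ∷ v) with Equivalence.to (T-∧ {allⱽ (λ v → p (false ∷ v))}) all-p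
allⱽ-sound {suc n} p all-p (false ∷ v) | all-false , _ = allⱽ-sound (λ v → p (false ∷ v)) all-false v
allⱽ-sound {suc n} p all-p (true ∷ v)  | _ , all-true  = allⱽ-sound (λ v → p (true ∷ v)) all-true v

anyⱽ-sound : (p : Vecₙ n → Bool) → T (anyⱽ p) → ∃[ v ] T (p v)
anyⱽ-sound {zero}  p any-p = [] , any-p
anyⱽ-sound {suc n} p any-p with Equivalence.to (T-∨ {anyⱽ (λ v → p (false ∷ v))}) any-p
... | inj₁ any-false = let v , pv = anyⱽ-sound (λ v → p (false ∷ v)) any-false in false ∷ v , pv
... | inj₂ any-true  = let v , pv = anyⱽ-sound (λ v → p (true ∷ v)) any-true in true ∷ v , pv

private
  hits : (cs : Vec (Vecₙ 3) 3) (d e : Vecₙ 3) → Bool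
  hits cs d e = ⌊ comb e cs ≟ⱽ d ⌋

  nonzero-kernel : (cs : Vec (Vecₙ 3) 3) (e : Vecₙ 3) → Bool
  nonzero-kernel cs e = not ⌊ e ≟ⱽ 𝟎 ⌋ ∧ ⌊ comb e cs ≟ⱽ 𝟎 ⌋

  spans-or-dependent : (cs : Vec (Vecₙ 3) 3) (d : Vecₙ 3) → Bool
  spans-or-dependent cs d = anyⱽ (hits cs d) ∨ anyⱽ (nonzero-kernel cs)

  spans-or-dependent-holds : ∀ a b c d → T (spans-or-dependent (a ∷ b ∷ c ∷ []) d)
  spans-or-dependent-holds a b c =
    allⱽ-sound (λ d → spans-or-dependent (a ∷ b ∷ c ∷ []) d)
      (allⱽ-sound (λ c → allⱽ λ d → spans-or-dependent (a ∷ b ∷ c ∷ []) d)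
        (allⱽ-sound (λ b → allⱽ λ c → allⱽ λ d → spans-or-dependent (a ∷ b ∷ c ∷ []) d)
          (allⱽ-sound (λ a → allⱽ λ b → allⱽ λ c → allⱽ λ d → spans-or-dependent (a ∷ b ∷ c ∷ []) d)
            tt a) b) c)

  moves : (M : Vec (Vecₙ 3) 3) (e : Vecₙ 3) → Bool
  moves M e = not ⌊ comb (comb (comb e M) M) M ≟ⱽ e ⌋

  nonzero-fixed : (M : Vec (Vecₙ 3) 3) (e : Vecₙ 3) → Bool
  nonzero-fixed M e = not ⌊ e ≟ⱽ 𝟎 ⌋ ∧ ⌊ comb e M ≟ⱽ e ⌋

  not-order-3-or-fixes : (M : Vec (Vecₙ 3) 3) → Bool
  not-order-3-or-fixes M = anyⱽ (moves M) ∨ anyⱽ (nonzero-fixed M)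

  not-order-3-or-fixes-holds : ∀ a b c → T (not-order-3-or-fixes (a ∷ b ∷ c ∷ []))
  not-order-3-or-fixes-holds a b =
    allⱽ-sound (λ c → not-order-3-or-fixes (a ∷ b ∷ c ∷ []))
      (allⱽ-sound (λ b → allⱽ λ c → not-order-3-or-fixes (a ∷ b ∷ c ∷ []))
        (allⱽ-sound (λ a → allⱽ λ b → allⱽ λ c → not-order-3-or-fixes (a ∷ b ∷ c ∷ [])) tt a) b)

independent-triple-spans-F₂³ : (cs : Vec (Vecₙ 3) 3) → LinIndep cs → ∀ d → Span cs d
independent-triple-spans-F₂³ cs@(a ∷ b ∷ c ∷ []) indep d
  with Equivalence.to (T-∨ {anyⱽ (hits cs d)}) (spans-or-dependent-holds a b c d)
... | inj₁ spans = let e , e↦d = anyⱽ-sound (hits cs d) spans in e , toWitness e↦d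
... | inj₂ dependent with anyⱽ-sound (nonzero-kernel cs) dependent
...   | e , e∈ker with Equivalence.to (T-∧ {not ⌊ e ≟ⱽ 𝟎 ⌋}) e∈ker
...     | e≢𝟎 , e↦𝟎 = ⊥-elim (toWitnessFalse e≢𝟎 (indep e (toWitness e↦𝟎)))

order-3-has-fixed-vector-F₂³ : (M : Vec (Vecₙ 3) 3) → (∀ e → comb (comb (comb e M) M) M ≡ e) →
  ∃[ e ] (e ≢ 𝟎 × comb e M ≡ e)
order-3-has-fixed-vector-F₂³ M@(a ∷ b ∷ c ∷ []) M³≡I
  with Equivalence.to (T-∨ {anyⱽ (moves M)}) (not-order-3-or-fixes-holds a b c)
... | inj₁ not-order-3 = let e , M³e≢e = anyⱽ-sound (moves M) not-order-3 in ⊥-elim (toWitnessFalse M³e≢e (M³≡I e))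
... | inj₂ fixes with anyⱽ-sound (nonzero-fixed M) fixes
...   | e , e-fixed with Equivalence.to (T-∧ {not ⌊ e ≟ⱽ 𝟎 ⌋}) e-fixed
...     | e≢𝟎 , e↦e = e , toWitnessFalse e≢𝟎 , toWitness e↦e

basis-in-span : (b : Vec (Vecₙ n) k) → Allⱽ (Span b) b
basis-in-span []      = []
basis-in-span (x ∷ b) =
  (true ∷ 𝟎 , trans (cong (x ⊕_) (comb-𝟎 b)) (⊕-identityʳ x)) ∷
  Allⱽ.map (λ { (c , c↦y) → false ∷ c , c↦y }) (basis-in-span b)

coordinates : (b : Vec (Vecₙ n) k) {v : Vec (Vecₙ n) j} → Allⱽ (Span b) v →
  ∃[ rows ] map (λ r → comb r b) rows ≡ v
coordinates b []                   = [] , refl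
coordinates b ((c , c↦x) ∷ v⊆span) =
  let rows , rows↦v = coordinates b v⊆span in c ∷ rows , cong₂ _∷_ c↦x rows↦v

independent-triple-spans : {S : Sub n} → IsSubspaceOfDim 3 S →
  (v : Vec (Vecₙ n) 3) → LinIndep v → Allⱽ S v → ∀ {y} → S y → Span v y
independent-triple-spans (b , _ , S⇔span) v v-indep v⊆S {y} y∈S =
  let d , d↦y = Equivalence.to (S⇔span y) y∈S
      e , e↦d = independent-triple-spans-F₂³ cs cs-indep d
  in e , trans (comb-v e) (trans (cong (λ c → comb c b) e↦d) d↦y)
  where
  cs-and-cs↦v = coordinates b (Allⱽ.map (λ {x} → Equivalence.to (S⇔span x)) v⊆S)
  cs = proj₁ cs-and-cs↦v
  comb-v : ∀ e → comb e v ≡ comb (comb e cs) b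
  comb-v e = trans (cong (comb e) (sym (proj₂ cs-and-cs↦v))) (comb-comb e cs b)
  cs-indep : LinIndep cs
  cs-indep e e↦𝟎 = v-indep e (trans (comb-v e) (trans (cong (λ c → comb c b) e↦𝟎) (comb-𝟎 b)))

invariant-3-space-has-fixed-vector : (g : Vecₙ n → Vecₙ n) → Additive g → (∀ y → g (g (g y)) ≡ y) →
  {S : Sub n} → IsSubspaceOfDim 3 S → (∀ {y} → S y → S (g y)) → ∃[ y ] (S y × y ≢ 𝟎 × g y ≡ y)
invariant-3-space-has-fixed-vector g g-⊕ g³≡id (b , b-indep , S⇔span) g-invariant =
  let e , e≢𝟎 , Me≡e = order-3-has-fixed-vector-F₂³ M M³≡I
  in comb e b , Equivalence.from (S⇔span _) (e , refl) , (λ e↦𝟎 → e≢𝟎 (b-indep e e↦𝟎)) ,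
     trans (g-comb e) (cong (λ c → comb c b) Me≡e)
  where
  gb⊆span : Allⱽ (Span b) (map g b)
  gb⊆span = Allⱽ.map⁺ (Allⱽ.map (λ {x} x∈span → Equivalence.to (S⇔span (g x))
                                  (g-invariant (Equivalence.from (S⇔span x) x∈span)))
                               (basis-in-span b))
  M = proj₁ (coordinates b gb⊆span)
  g-comb : ∀ c → g (comb c b) ≡ comb (comb c M) b
  g-comb c = begin
    g (comb c b)                      ≡⟨ comb-map g g-⊕ c b ⟩
    comb c (map g b)                  ≡⟨ cong (comb c) (proj₂ (coordinates b gb⊆span)) ⟨
    comb c (map (λ r → comb r b) M)   ≡⟨ comb-comb c M b ⟩
    comb (comb c M) b                 ∎
  M³≡I : ∀ c → comb (comb (comb c M) M) M ≡ c
  M³≡I c = comb-injective b b-indep _ c (begin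
    comb (comb (comb (comb c M) M) M) b   ≡⟨ g-comb (comb (comb c M) M) ⟨
    g (comb (comb (comb c M) M) b)        ≡⟨ cong g (g-comb (comb c M)) ⟨
    g (g (comb (comb c M) b))             ≡⟨ cong (λ z → g (g z)) (g-comb c) ⟨
    g (g (g (comb c b)))                  ≡⟨ g³≡id (comb c b) ⟩
    comb c b                              ∎)

dim3-⊆⇒≐ : {S T : Sub n} → IsSubspaceOfDim 3 S → IsSubspaceOfDim 3 T → S ⊆ T → S ≐ T
dim3-⊆⇒≐ (b , b-indep , S⇔span) T-dim S⊆T y = mk⇔ (S⊆T y)
  (λ y∈T → Equivalence.from (S⇔span y) (independent-triple-spans T-dim b b-indep b⊆T y∈T))
  where
  b⊆T = Allⱽ.map (λ {x} x∈span → S⊆T x (Equivalence.from (S⇔span x) x∈span)) (basis-in-span b)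

no-3-space-within-pair : {S : Sub n} → IsSubspaceOfDim 3 S → (x : Vecₙ n) →
  ¬ (∀ {y} → S y → y ≡ 𝟎 ⊎ y ≡ x)
no-3-space-within-pair (b₁ ∷ b₂ ∷ _ ∷ [] , indep , S⇔span) x S⊆pair
  with S⊆pair (Equivalence.from (S⇔span _) (true ∷ false ∷ false ∷ [] , refl))
     | S⊆pair (Equivalence.from (S⇔span _) (false ∷ true ∷ false ∷ [] , refl))
... | inj₁ b₁≡𝟎  | _         = contradiction (indep (true ∷ false ∷ false ∷ []) b₁≡𝟎) λ ()
... | inj₂ _     | inj₁ b₂≡𝟎 = contradiction (indep (false ∷ true ∷ false ∷ []) b₂≡𝟎) λ ()
... | inj₂ b₁≡x  | inj₂ b₂≡x = contradiction (indep (true ∷ true ∷ false ∷ []) b₁⊕b₂≡𝟎) λ ()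
  where
  b₁⊕b₂≡𝟎 : b₁ ⊕ (b₂ ⊕ 𝟎) ≡ 𝟎
  b₁⊕b₂≡𝟎 = trans (cong₂ _⊕_ (trans (sym (⊕-identityʳ b₁)) b₁≡x) b₂≡x) (⊕-self x)

≐-refl : (S : Sub n) → S ≐ S
≐-refl S y = ⇔.refl

≐-sym : {S T : Sub n} → S ≐ T → T ≐ S
≐-sym S≐T y = ⇔.sym (S≐T y)

≐-trans : {S T U : Sub n} → S ≐ T → T ≐ U → S ≐ U
≐-trans S≐T T≐U y = ⇔.trans (S≐T y) (T≐U y)

img-resp : (A : Mat n) {S T : Sub n} → S ≐ T → img A S ≐ img A T
img-resp A S≐T y = mk⇔ (λ (x , x∈S , x↦y) → x , Equivalence.to (S≐T x) x∈S , x↦y)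
                       (λ (x , x∈T , x↦y) → x , Equivalence.from (S≐T x) x∈T , x↦y)

+ˢ-respˡ : {S T U : Sub n} → S ≐ T → (S +ˢ U) ≐ (T +ˢ U)
+ˢ-respˡ S≐T y = mk⇔ (λ (s , u , s∈S , u∈U , s+u≡y) → s , u , Equivalence.to (S≐T s) s∈S , u∈U , s+u≡y)
                     (λ (t , u , t∈T , u∈U , t+u≡y) → t , u , Equivalence.from (S≐T t) t∈T , u∈U , t+u≡y)

∈ᴰ-resp : {D : Design n} {S T : Sub n} → S ≐ T → S ∈ᴰ D → T ∈ᴰ D
∈ᴰ-resp S≐T = Any.map (λ B≐S → ≐-trans B≐S S≐T)

∈⇒∈ᴰ : {D : Design n} {B : Sub n} → Any (_≡ B) D → B ∈ᴰ D
∈⇒∈ᴰ = Any.map λ { refl → ≐-refl _ }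

dim-resp : {S T : Sub n} → S ≐ T → IsSubspaceOfDim k S → IsSubspaceOfDim k T
dim-resp S≐T (b , indep , S⇔span) =
  b , indep , λ y → mk⇔ (Equivalence.to (S⇔span y) ∘ Equivalence.from (S≐T y))
                        (Equivalence.to (S≐T y) ∘ Equivalence.from (S⇔span y))

fixedType1-resp : (A : Mat n) {S T : Sub n} → S ≐ T → FixedType1 A S → FixedType1 A T
fixedType1-resp A S≐T (AS≐S , x , x∈S , Ax≢x) =
  ≐-trans (img-resp A (≐-sym S≐T)) (≐-trans AS≐S S≐T) , x , Equivalence.to (S≐T x) x∈S , Ax≢x

0₄ 1₄ ω ω² : F4
0₄ = false , false
1₄ = true , false
ω  = false , true
ω² = true , true

infix 4 _≟₄_
_≟₄_ : (a b : F4) → Dec (a ≡ b)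
_≟₄_ = ×-≡-dec _≟ᵇ_ _≟ᵇ_

∀ᵇ? : {P : Bool → Set} → (∀ b → Dec (P b)) → Dec (∀ b → P b)
∀ᵇ? P? = map′ (λ { (p , _) false → p ; (_ , p) true → p }) (λ h → h false , h true) (P? false ×-dec P? true)

∀₄? : {P : F4 → Set} → (∀ a → Dec (P a)) → Dec (∀ a → P a)
∀₄? P? = map′ (λ h (a , b) → h a b) (λ h a b → h (a , b)) (∀ᵇ? λ a → ∀ᵇ? λ b → P? (a , b))

by-exhaustion : {P : F4 → Set} (P? : ∀ a → Dec (P a)) → {True (∀₄? P?)} → ∀ a → P a
by-exhaustion P? {all-P} = toWitness all-P

*₄-assoc : ∀ a b c → a *₄ (b *₄ c) ≡ (a *₄ b) *₄ c
*₄-assoc = by-exhaustion λ a → ∀₄? λ b → ∀₄? λ c → a *₄ (b *₄ c) ≟₄ (a *₄ b) *₄ c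

*₄-identityˡ : ∀ a → 1₄ *₄ a ≡ a
*₄-identityˡ = by-exhaustion λ a → 1₄ *₄ a ≟₄ a

*₄-identityʳ : ∀ a → a *₄ 1₄ ≡ a
*₄-identityʳ = by-exhaustion λ a → a *₄ 1₄ ≟₄ a

*₄-zeroʳ : ∀ a → a *₄ 0₄ ≡ 0₄
*₄-zeroʳ = by-exhaustion λ a → a *₄ 0₄ ≟₄ 0₄

*₄-distribʳ-+₄ : ∀ a b c → (a +₄ b) *₄ c ≡ (a *₄ c) +₄ (b *₄ c)
*₄-distribʳ-+₄ = by-exhaustion λ a → ∀₄? λ b → ∀₄? λ c → (a +₄ b) *₄ c ≟₄ (a *₄ c) +₄ (b *₄ c)

+₄-identityʳ : ∀ a → a +₄ 0₄ ≡ a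
+₄-identityʳ = by-exhaustion λ a → a +₄ 0₄ ≟₄ a

+₄-self : ∀ a → a +₄ a ≡ 0₄
+₄-self = by-exhaustion λ a → a +₄ a ≟₄ 0₄

+₄≡0₄⇒≡ : ∀ a b → a +₄ b ≡ 0₄ → a ≡ b
+₄≡0₄⇒≡ = by-exhaustion λ a → ∀₄? λ b → (a +₄ b ≟₄ 0₄) →-dec (a ≟₄ b)

*₄-cancelʳ-0₄ : ∀ a b → a *₄ b ≡ 0₄ → b ≢ 0₄ → a ≡ 0₄
*₄-cancelʳ-0₄ = by-exhaustion λ a → ∀₄? λ b → (a *₄ b ≟₄ 0₄) →-dec (¬? (b ≟₄ 0₄) →-dec (a ≟₄ 0₄))

ω-fixes-only-0₄ : ∀ a → ω *₄ a ≡ a → a ≡ 0₄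
ω-fixes-only-0₄ = by-exhaustion λ a → (ω *₄ a ≟₄ a) →-dec (a ≟₄ 0₄)

ω³-action : ∀ a → ω *₄ (ω *₄ (ω *₄ a)) ≡ a
ω³-action = by-exhaustion λ a → ω *₄ (ω *₄ (ω *₄ a)) ≟₄ a

-- F₄ˣ is cyclic of order 3, so a⁻¹ = a².
infix 30 _⁻¹₄
_⁻¹₄ : F4 → F4
a ⁻¹₄ = a *₄ a

*₄-inverseˡ : ∀ a → a ≢ 0₄ → a ⁻¹₄ *₄ a ≡ 1₄
*₄-inverseˡ = by-exhaustion λ a → ¬? (a ≟₄ 0₄) →-dec (a ⁻¹₄ *₄ a ≟₄ 1₄)

*₄-inverseʳ : ∀ a → a ≢ 0₄ → a *₄ a ⁻¹₄ ≡ 1₄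
*₄-inverseʳ = by-exhaustion λ a → ¬? (a ≟₄ 0₄) →-dec (a *₄ a ⁻¹₄ ≟₄ 1₄)

infixr 7 _•_
infixl 6 _+ᵥ_

_•_ : F4 → Vec F4 m → Vec F4 m
l • u = map (l *₄_) u

_+ᵥ_ : Vec F4 m → Vec F4 m → Vec F4 m
_+ᵥ_ = zipWith _+₄_

0ᵥ : Vec F4 m
0ᵥ = replicate _ 0₄

•-assoc : ∀ l k (u : Vec F4 m) → l • k • u ≡ (l *₄ k) • u
•-assoc l k u = trans (sym (map-∘ (l *₄_) (k *₄_) u)) (map-cong (*₄-assoc l k) u)

•-identity : (u : Vec F4 m) → 1₄ • u ≡ u
•-identity u = trans (map-cong *₄-identityˡ u) (map-id u)

0₄• : (u : Vec F4 m) → 0₄ • u ≡ 0ᵥ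
0₄• u = map-const u 0₄

•-distribʳ-+₄ : ∀ l k (u : Vec F4 m) → l • u +ᵥ k • u ≡ (l +₄ k) • u
•-distribʳ-+₄ l k []      = refl
•-distribʳ-+₄ l k (a ∷ u) = cong₂ _∷_ (sym (*₄-distribʳ-+₄ l k a)) (•-distribʳ-+₄ l k u)

+ᵥ-identityʳ : (u : Vec F4 m) → u +ᵥ 0ᵥ ≡ u
+ᵥ-identityʳ = zipWith-identityʳ +₄-identityʳ

+ᵥ-self : (u : Vec F4 m) → u +ᵥ u ≡ 0ᵥ
+ᵥ-self []      = refl
+ᵥ-self (a ∷ u) = cong₂ _∷_ (+₄-self a) (+ᵥ-self u)

+ᵥ≡0ᵥ⇒≡ : (u v : Vec F4 m) → u +ᵥ v ≡ 0ᵥ → u ≡ v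
+ᵥ≡0ᵥ⇒≡ []      []      _   = refl
+ᵥ≡0ᵥ⇒≡ (a ∷ u) (b ∷ v) u+v≡0 =
  cong₂ _∷_ (+₄≡0₄⇒≡ a b (∷-injectiveˡ u+v≡0)) (+ᵥ≡0ᵥ⇒≡ u v (∷-injectiveʳ u+v≡0))

•≡0ᵥ⇒≡0₄ : ∀ l (u : Vec F4 m) → u ≢ 0ᵥ → l • u ≡ 0ᵥ → l ≡ 0₄
•≡0ᵥ⇒≡0₄ l []      u≢0 _    = contradiction refl u≢0
•≡0ᵥ⇒≡0₄ l (a ∷ u) u≢0 lu≡0 with a ≟₄ 0₄
... | yes refl = •≡0ᵥ⇒≡0₄ l u (λ u≡0 → u≢0 (cong (0₄ ∷_) u≡0)) (∷-injectiveʳ lu≡0)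
... | no a≢0   = *₄-cancelʳ-0₄ l a (∷-injectiveˡ lu≡0) a≢0

ω•-fixes-only-0ᵥ : (u : Vec F4 m) → ω • u ≡ u → u ≡ 0ᵥ
ω•-fixes-only-0ᵥ []      _      = refl
ω•-fixes-only-0ᵥ (a ∷ u) ωu≡u =
  cong₂ _∷_ (ω-fixes-only-0₄ a (∷-injectiveˡ ωu≡u)) (ω•-fixes-only-0ᵥ u (∷-injectiveʳ ωu≡u))

ω•³ : (u : Vec F4 m) → ω • ω • ω • u ≡ u
ω•³ []      = refl
ω•³ (a ∷ u) = cong₂ _∷_ (ω³-action a) (ω•³ u)

pairUp : Vecₙ (m + m) → Vec F4 m
pairUp {m} c = zip (take m c) (drop m c)

zip-⊕ : (a b a′ b′ : Vecₙ m) → zip (a ⊕ a′) (b ⊕ b′) ≡ zip a b +ᵥ zip a′ b′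
zip-⊕ []      []      []        []        = refl
zip-⊕ (x ∷ a) (y ∷ b) (x′ ∷ a′) (y′ ∷ b′) = cong (_ ∷_) (zip-⊕ a b a′ b′)

zip-map-proj : (u : Vec F4 m) → zip (map proj₁ u) (map proj₂ u) ≡ u
zip-map-proj []      = refl
zip-map-proj (x ∷ u) = cong (x ∷_) (zip-map-proj u)

pairUp-⊕ : (c d : Vecₙ (m + m)) → pairUp (c ⊕ d) ≡ pairUp c +ᵥ pairUp d
pairUp-⊕ {m} c d =
  trans (cong₂ zip (take-zipWith _xor_ c d) (drop-zipWith _xor_ c d)) (zip-⊕ (take m c) (drop m c) (take m d) (drop m d))

pairUp-injective : (c d : Vecₙ (m + m)) → pairUp c ≡ pairUp d → c ≡ d
pairUp-injective {m} c d c≡d = begin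
  c                      ≡⟨ take++drop≡id m c ⟨
  take m c ++ drop m c   ≡⟨ cong (uncurry _++_) halves ⟩
  take m d ++ drop m d   ≡⟨ take++drop≡id m d ⟩
  d                      ∎
  where
  halves : (take m c , drop m c) ≡ (take m d , drop m d)
  halves = trans (sym (unzip∘zip (take m c) (drop m c))) (trans (cong unzip c≡d) (unzip∘zip (take m d) (drop m d)))

pairUp-surjective : (u : Vec F4 m) → ∃[ c ] pairUp c ≡ u
pairUp-surjective {m} u = c , (begin
  zip (take m c) (drop m c)            ≡⟨ cong₂ zip (proj₁ halves) (proj₂ halves) ⟩
  zip (map proj₁ u) (map proj₂ u)      ≡⟨ zip-map-proj u ⟩
  u                                    ∎)
  where
  c = map proj₁ u ++ map proj₂ u
  halves = ++-injective (take m c) (map proj₁ u) (take++drop≡id m c)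

-- The points of PG(m−1, 4)

length-cartesianProductWith : {A B C : Set} (f : A → B → C) (xs : List A) (ys : List B) →
  length (cartesianProductWith f xs ys) ≡ length xs * length ys
length-cartesianProductWith f []ᴸ       ys = refl
length-cartesianProductWith f (x ∷ᴸ xs) ys = begin
  length (List.map (f x) ys ++ᴸ cartesianProductWith f xs ys)
    ≡⟨ length-++ (List.map (f x) ys) ⟩
  length (List.map (f x) ys) + length (cartesianProductWith f xs ys)
    ≡⟨ cong₂ _+_ (length-map (f x) ys) (length-cartesianProductWith f xs ys) ⟩
  length ys + length xs * length ys ∎

F4-elements : List F4
F4-elements = 0₄ ∷ᴸ 1₄ ∷ᴸ ω ∷ᴸ ω² ∷ᴸ []ᴸ

F4-elements-complete : (a : F4) → a ∈ F4-elements
F4-elements-complete (false , false) = here refl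
F4-elements-complete (true  , false) = there (here refl)
F4-elements-complete (false , true)  = there (there (here refl))
F4-elements-complete (true  , true)  = there (there (there (here refl)))

F4-elements-unique : Unique F4-elements
F4-elements-unique = ((λ ()) ∷ᴬ (λ ()) ∷ᴬ (λ ()) ∷ᴬ []ᴬ) ∷ᴾ ((λ ()) ∷ᴬ (λ ()) ∷ᴬ []ᴬ) ∷ᴾ ((λ ()) ∷ᴬ []ᴬ) ∷ᴾ []ᴬ ∷ᴾ []ᴾ

allVectors : ∀ m → List (Vec F4 m)
allVectors zero    = [] ∷ᴸ []ᴸ
allVectors (suc m) = cartesianProductWith _∷_ F4-elements (allVectors m)

allVectors-complete : (u : Vec F4 m) → u ∈ allVectors m
allVectors-complete []      = here refl
allVectors-complete (a ∷ u) =
  Any.cartesianProductWith⁺ _∷_ (cong₂ _∷_) (F4-elements-complete a) (allVectors-complete u)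

allVectors-unique : ∀ m → Unique (allVectors m)
allVectors-unique zero    = []ᴬ ∷ᴾ []ᴾ
allVectors-unique (suc m) = Unique.cartesianProductWith⁺ _∷_ ∷-injective F4-elements-unique (allVectors-unique m)

length-allVectors : ∀ m → length (allVectors m) ≡ 4 ^ m
length-allVectors zero    = refl
length-allVectors (suc m) =
  trans (length-cartesianProductWith _∷_ F4-elements (allVectors m)) (cong (4 *_) (length-allVectors m))

_∝_ : Vec F4 m → Vec F4 m → Set
u ∝ v = ∃[ l ] l • v ≡ u

-- One representative for each point: the first nonzero coordinate is 1.
projectivePoints : ∀ m → List (Vec F4 m)
projectivePoints zero    = []ᴸ
projectivePoints (suc m) = List.map (1₄ ∷_) (allVectors m) ++ᴸ List.map (0₄ ∷_) (projectivePoints m)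

projectivePoints-nonzero : ∀ m → All (_≢ 0ᵥ) (projectivePoints m)
projectivePoints-nonzero zero    = []ᴬ
projectivePoints-nonzero (suc m) = All.++⁺
  (All.map⁺ (All.universal (λ _ 1∷v≡0 → 1₄≢0₄ (∷-injectiveˡ 1∷v≡0)) (allVectors m)))
  (All.map⁺ (All.map (λ w≢0 0∷w≡0 → w≢0 (∷-injectiveʳ 0∷w≡0)) (projectivePoints-nonzero m)))
  where
  1₄≢0₄ : 1₄ ≢ 0₄
  1₄≢0₄ ()

projectivePoints-distinct : ∀ m → AllPairs (λ u v → ¬ u ∝ v) (projectivePoints m)
projectivePoints-distinct zero    = []ᴾ
projectivePoints-distinct (suc m) = AllPairs.++⁺ leading trailing across
  where
  leading : AllPairs (λ u v → ¬ u ∝ v) (List.map (1₄ ∷_) (allVectors m))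
  leading = AllPairs.map⁺ (AllPairs.map (λ {v} {v′} v≢v′ (l , l•1v′≡1v) →
    let l≡1 = trans (sym (*₄-identityʳ l)) (∷-injectiveˡ l•1v′≡1v)
    in v≢v′ (sym (trans (sym (•-identity v′)) (trans (cong (_• v′) (sym l≡1)) (∷-injectiveʳ l•1v′≡1v)))))
    (allVectors-unique m))
  trailing : AllPairs (λ u v → ¬ u ∝ v) (List.map (0₄ ∷_) (projectivePoints m))
  trailing = AllPairs.map⁺ (AllPairs.map (λ ¬w∝w′ (l , l•0w′≡0w) → ¬w∝w′ (l , ∷-injectiveʳ l•0w′≡0w))
    (projectivePoints-distinct m))
  across : All (λ u → All (λ v → ¬ u ∝ v) (List.map (0₄ ∷_) (projectivePoints m))) (List.map (1₄ ∷_) (allVectors m))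
  across = All.map⁺ (All.universal (λ _ → All.map⁺ (All.universal (λ _ (l , l•0w≡1v) →
    0₄≢1₄ (trans (sym (*₄-zeroʳ l)) (∷-injectiveˡ l•0w≡1v))) (projectivePoints m))) (allVectors m))
    where
    0₄≢1₄ : 0₄ ≢ 1₄
    0₄≢1₄ ()

projectivePoints-complete : (u : Vec F4 m) → u ≢ 0ᵥ →
  ∃[ l ] ∃[ u₀ ] (l ≢ 0₄ × u₀ ∈ projectivePoints m × u ≡ l • u₀)
projectivePoints-complete []      u≢0 = contradiction refl u≢0
projectivePoints-complete (a ∷ u) u≢0 with a ≟₄ 0₄
... | yes refl =
  let l , u₀ , l≢0 , u₀∈ , u≡lu₀ = projectivePoints-complete u (u≢0 ∘ cong (0₄ ∷_))
  in l , 0₄ ∷ u₀ , l≢0 , Any.++⁺ʳ _ (Any.map⁺ (Any.map (cong (0₄ ∷_)) u₀∈)) , cong₂ _∷_ (sym (*₄-zeroʳ l)) u≡lu₀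
... | no a≢0 =
  a , 1₄ ∷ a ⁻¹₄ • u , a≢0 , Any.++⁺ˡ (Any.map⁺ (Any.map (cong (1₄ ∷_)) (allVectors-complete _))) ,
  cong₂ _∷_ (sym (*₄-identityʳ a)) (begin
    u                   ≡⟨ •-identity u ⟨
    1₄ • u              ≡⟨ cong (_• u) (*₄-inverseʳ a a≢0) ⟨
    (a *₄ a ⁻¹₄) • u    ≡⟨ •-assoc a (a ⁻¹₄) u ⟨
    a • a ⁻¹₄ • u       ∎)

3*length-projectivePoints+1 : ∀ m → 3 * length (projectivePoints m) + 1 ≡ 4 ^ m
3*length-projectivePoints+1 zero    = refl
3*length-projectivePoints+1 (suc m) = begin
  3 * length (List.map (1₄ ∷_) (allVectors m) ++ᴸ List.map (0₄ ∷_) (projectivePoints m)) + 1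
    ≡⟨ cong (λ k → 3 * k + 1) (trans (length-++ (List.map (1₄ ∷_) (allVectors m)))
                                     (cong₂ _+_ (length-map _ (allVectors m)) (length-map _ (projectivePoints m)))) ⟩
  3 * (length (allVectors m) + N) + 1  ≡⟨ cong (λ k → 3 * (k + N) + 1) (length-allVectors m) ⟩
  3 * (4 ^ m + N) + 1                  ≡⟨ cong (λ k → 3 * (k + N) + 1) (3*length-projectivePoints+1 m) ⟨
  3 * ((3 * N + 1) + N) + 1            ≡⟨ arithmetic N ⟩
  4 * (3 * N + 1)                      ≡⟨ cong (4 *_) (3*length-projectivePoints+1 m) ⟩
  4 * 4 ^ m                            ∎
  where
  N = length (projectivePoints m)
  arithmetic : ∀ N → 3 * ((3 * N + 1) + N) + 1 ≡ 4 * (3 * N + 1)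
  arithmetic = solve-∀

2^[m+m]≡4^m : ∀ m → 2 ^ (m + m) ≡ 4 ^ m
2^[m+m]≡4^m zero    = refl
2^[m+m]≡4^m (suc m) = begin
  2 * 2 ^ (m + suc m)  ≡⟨ cong (λ k → 2 * 2 ^ k) (+-suc m m) ⟩
  2 * (2 * 2 ^ (m + m)) ≡⟨ *-assoc 2 2 (2 ^ (m + m)) ⟨
  4 * 2 ^ (m + m)      ≡⟨ cong (4 *_) (2^[m+m]≡4^m m) ⟩
  4 * 4 ^ m            ∎

length-projectivePoints : ∀ m → length (projectivePoints m) ≡ (2 ^ (m + m) ∸ 1) / 3
length-projectivePoints m = sym (begin
  (2 ^ (m + m) ∸ 1) / 3  ≡⟨ cong (λ k → (k ∸ 1) / 3) (trans (2^[m+m]≡4^m m) (sym (3*length-projectivePoints+1 m))) ⟩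
  (3 * N + 1 ∸ 1) / 3    ≡⟨ cong (_/ 3) (trans (m+n∸n≡m (3 * N) 1) (*-comm 3 N)) ⟩
  N * 3 / 3              ≡⟨ m*n/n≡m N 3 ⟩
  N                      ∎)
  where
  N = length (projectivePoints m)

-- Coordinates in which A_{v,1} acts as (u , t) ↦ (ω u , t) on F₄ᵐ × F₂

interleave : Vec F4 m → Bool → List Bool
interleave []            t = t ∷ᴸ []ᴸ
interleave ((a , b) ∷ u) t = a ∷ᴸ b ∷ᴸ interleave u t

length-interleave : (u : Vec F4 m) (t : Bool) → length (interleave u t) ≡ suc (m + m)
length-interleave []                     t = refl
length-interleave {suc m} ((a , b) ∷ u) t = cong (suc ∘ suc) (trans (length-interleave u t) (sym (+-suc m m)))

-- false beyond the end of the list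
nth : List Bool → ℕ → Bool
nth []ᴸ       _       = false
nth (x ∷ᴸ xs) zero    = x
nth (x ∷ᴸ xs) (suc a) = nth xs a

embed : Vec F4 m → Bool → Vecₙ (suc (m + m))
embed u t = tabulate (nth (interleave u t) ∘ toℕ)

-- The entries of A_{v,1} = diag(J, …, J, 1) with J = [[0,1],[1,1]], by recursion on the
-- number of J-blocks; the values outside the matrix are those of the defining formula.
blockDiag : ℕ → ℕ → ℕ → Bool
blockDiag zero    a             b             = ⌊ a /2⌋ ≡ᵇ ⌊ b /2⌋
blockDiag (suc m) 0             0             = false
blockDiag (suc m) 0             1             = true
blockDiag (suc m) 1             0             = true
blockDiag (suc m) 1             1             = true
blockDiag (suc m) 0             (suc (suc b)) = false
blockDiag (suc m) 1             (suc (suc b)) = false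
blockDiag (suc m) (suc (suc a)) 0             = false
blockDiag (suc m) (suc (suc a)) 1             = false
blockDiag (suc m) (suc (suc a)) (suc (suc b)) = blockDiag m a b

A-v1-blockDiag : ∀ m a b → (⌊ a /2⌋ ≡ᵇ ⌊ b /2⌋) ∧ not ((a ≡ᵇ b) ∧ ((a % 2 ≡ᵇ 0) ∧ (a <ᵇ m + m))) ≡ blockDiag m a b
A-v1-blockDiag zero a b =
  trans (cong (λ c → (⌊ a /2⌋ ≡ᵇ ⌊ b /2⌋) ∧ not c)
              (trans (cong ((a ≡ᵇ b) ∧_) (∧-zeroʳ (a % 2 ≡ᵇ 0))) (∧-zeroʳ (a ≡ᵇ b))))
        (∧-identityʳ _)
A-v1-blockDiag (suc m) 0             0             = refl
A-v1-blockDiag (suc m) 0             1             = refl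
A-v1-blockDiag (suc m) 1             0             = refl
A-v1-blockDiag (suc m) 1             1             = refl
A-v1-blockDiag (suc m) 0             (suc (suc b)) = refl
A-v1-blockDiag (suc m) 1             (suc (suc b)) = refl
A-v1-blockDiag (suc m) (suc (suc a)) 0             = refl
A-v1-blockDiag (suc m) (suc (suc a)) 1             = refl
A-v1-blockDiag (suc m) (suc (suc a)) (suc (suc b)) =
  trans (cong (λ k → (⌊ a /2⌋ ≡ᵇ ⌊ b /2⌋) ∧ not ((a ≡ᵇ b) ∧ ((a % 2 ≡ᵇ 0) ∧ (suc a <ᵇ k)))) (+-suc m m))
        (A-v1-blockDiag m a b)

dot : List Bool → (ℕ → Bool) → Bool
dot []ᴸ       h = false
dot (x ∷ᴸ xs) h = (x ∧ h 0) xor dot xs (h ∘ suc)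

dot-false : (xs : List Bool) → dot xs (λ _ → false) ≡ false
dot-false []ᴸ       = refl
dot-false (x ∷ᴸ xs) = trans (cong (_xor dot xs (λ _ → false)) (∧-zeroʳ x)) (dot-false xs)

⊕Σ-nth : (xs : List Bool) (h : ℕ → Bool) → length xs ≡ n →
  ⊕Σ {n} (λ i → nth xs (toℕ i) ∧ h (toℕ i)) ≡ dot xs h
⊕Σ-nth []ᴸ       h refl = refl
⊕Σ-nth (x ∷ᴸ xs) h refl = cong ((x ∧ h 0) xor_) (⊕Σ-nth xs (h ∘ suc) refl)

dot-interleave-blockDiag : ∀ m (u : Vec F4 m) t b → b < suc (m + m) →
  dot (interleave u t) (λ a → blockDiag m a b) ≡ nth (interleave (ω • u) t) b
dot-interleave-blockDiag zero    []            t zero          _ = trans (xor-identityʳ (t ∧ true)) (∧-identityʳ t)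
dot-interleave-blockDiag zero    []            t (suc b)       (s≤s ())
dot-interleave-blockDiag (suc m) ((x , y) ∷ u) t zero          _ =
  trans (cong₂ (λ p q → p xor ((y ∧ true) xor q)) (∧-zeroʳ x) (dot-false (interleave u t)))
        (trans (xor-identityʳ (y ∧ true)) (∧-identityʳ y))
dot-interleave-blockDiag (suc m) ((x , y) ∷ u) t 1             _ =
  cong₂ _xor_ (∧-identityʳ x) (trans (cong₂ _xor_ (∧-identityʳ y) (dot-false (interleave u t))) (xor-identityʳ y))
dot-interleave-blockDiag (suc m) ((x , y) ∷ u) t (suc (suc b)) (s≤s (s≤s b<)) =
  trans (cong₂ (λ p q → p xor (q xor dot (interleave u t) (λ a → blockDiag m a b))) (∧-zeroʳ x) (∧-zeroʳ y))
        (dot-interleave-blockDiag m u t b (subst (b <_) (+-suc m m) b<))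

embed-A : ∀ m (u : Vec F4 m) t → embed u t ⋆ A-v1 m ≡ embed (ω • u) t
embed-A m u t = ≗-lookup⇒≡ _ _ λ j → begin
  lookup (embed u t ⋆ A-v1 m) j
    ≡⟨ lookup-⋆ (embed u t) (A-v1 m) j ⟩
  ⊕Σ {suc (m + m)} (λ i → lookup (embed u t) i ∧ A-v1 m i j)
    ≡⟨ ⊕Σ-cong {suc (m + m)} (λ i → cong₂ _∧_ (lookup∘tabulate (nth (interleave u t) ∘ toℕ) i) (A-v1-blockDiag m (toℕ i) (toℕ j))) ⟩
  ⊕Σ {suc (m + m)} (λ i → nth (interleave u t) (toℕ i) ∧ blockDiag m (toℕ i) (toℕ j))
    ≡⟨ ⊕Σ-nth (interleave u t) (λ a → blockDiag m a (toℕ j)) (length-interleave u t) ⟩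
  dot (interleave u t) (λ a → blockDiag m a (toℕ j))
    ≡⟨ dot-interleave-blockDiag m u t (toℕ j) (toℕ<n j) ⟩
  nth (interleave (ω • u) t) (toℕ j)
    ≡⟨ lookup∘tabulate (nth (interleave (ω • u) t) ∘ toℕ) j ⟨
  lookup (embed (ω • u) t) j ∎

nth-interleave-+ : (u v : Vec F4 m) (t s : Bool) (a : ℕ) →
  nth (interleave (u +ᵥ v) (t xor s)) a ≡ nth (interleave u t) a xor nth (interleave v s) a
nth-interleave-+ []                 []                 t s zero          = refl
nth-interleave-+ []                 []                 t s (suc a)       = refl
nth-interleave-+ ((x , y) ∷ u)      ((x′ , y′) ∷ v)   t s zero          = refl
nth-interleave-+ ((x , y) ∷ u)      ((x′ , y′) ∷ v)   t s 1             = refl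
nth-interleave-+ ((x , y) ∷ u)      ((x′ , y′) ∷ v)   t s (suc (suc a)) = nth-interleave-+ u v t s a

embed-+ : (u v : Vec F4 m) (t s : Bool) → embed (u +ᵥ v) (t xor s) ≡ embed u t ⊕ embed v s
embed-+ u v t s = ≗-lookup⇒≡ _ _ λ i → begin
  lookup (embed (u +ᵥ v) (t xor s)) i
    ≡⟨ lookup∘tabulate (nth (interleave (u +ᵥ v) (t xor s)) ∘ toℕ) i ⟩
  nth (interleave (u +ᵥ v) (t xor s)) (toℕ i)
    ≡⟨ nth-interleave-+ u v t s (toℕ i) ⟩
  nth (interleave u t) (toℕ i) xor nth (interleave v s) (toℕ i)
    ≡⟨ cong₂ _xor_ (lookup∘tabulate (nth (interleave u t) ∘ toℕ) i)
                   (lookup∘tabulate (nth (interleave v s) ∘ toℕ) i) ⟨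
  lookup (embed u t) i xor lookup (embed v s) i
    ≡⟨ lookup-zipWith _xor_ i (embed u t) (embed v s) ⟨
  lookup (embed u t ⊕ embed v s) i ∎

-- Junk values for lists of the wrong length.
deinterleave : ∀ m → List Bool → Vec F4 m × Bool
deinterleave zero    (t ∷ᴸ _)       = [] , t
deinterleave zero    []ᴸ            = [] , false
deinterleave (suc m) (a ∷ᴸ b ∷ᴸ xs) = let u , t = deinterleave m xs in (a , b) ∷ u , t
deinterleave (suc m) _              = 0ᵥ , false

deinterleave-interleave : (u : Vec F4 m) (t : Bool) → deinterleave m (interleave u t) ≡ (u , t)
deinterleave-interleave []            t = refl
deinterleave-interleave ((a , b) ∷ u) t rewrite deinterleave-interleave u t = refl

interleave-deinterleave : ∀ m (xs : List Bool) → length xs ≡ suc (m + m) →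
  uncurry interleave (deinterleave m xs) ≡ xs
interleave-deinterleave zero    (t ∷ᴸ []ᴸ)     _ = refl
interleave-deinterleave (suc m) (a ∷ᴸ b ∷ᴸ xs) len =
  cong (λ ys → a ∷ᴸ b ∷ᴸ ys)
       (interleave-deinterleave m xs (trans (suc-injective (suc-injective len)) (+-suc m m)))

toList-tabulate-nth : (xs : List Bool) → length xs ≡ n → toList (tabulate {n} (nth xs ∘ toℕ)) ≡ xs
toList-tabulate-nth []ᴸ       refl = refl
toList-tabulate-nth (x ∷ᴸ xs) refl = cong (x ∷ᴸ_) (toList-tabulate-nth xs refl)

nth-toList : (z : Vecₙ n) (i : Fin n) → nth (toList z) (toℕ i) ≡ lookup z i
nth-toList (x ∷ z) fzero    = refl
nth-toList (x ∷ z) (fsuc i) = nth-toList z i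

split : ∀ m → Vecₙ (suc (m + m)) → Vec F4 m × Bool
split m z = deinterleave m (toList z)

embed-split : ∀ m (z : Vecₙ (suc (m + m))) → uncurry embed (split m z) ≡ z
embed-split m z = ≗-lookup⇒≡ _ _ λ i → begin
  lookup (uncurry embed (split m z)) i   ≡⟨ lookup∘tabulate (nth (uncurry interleave (split m z)) ∘ toℕ) i ⟩
  nth (uncurry interleave (split m z)) (toℕ i)
    ≡⟨ cong (λ xs → nth xs (toℕ i)) (interleave-deinterleave m (toList z) (length-toList z)) ⟩
  nth (toList z) (toℕ i)                 ≡⟨ nth-toList z i ⟩
  lookup z i                             ∎

split-embed : (u : Vec F4 m) (t : Bool) → split m (embed u t) ≡ (u , t)
split-embed {m} u t = trans (cong (deinterleave m) (toList-tabulate-nth (interleave u t) (length-interleave u t)))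
                        (deinterleave-interleave u t)

module TypeA-v1 (m : ℕ) (A P Q : Mat (suc (m + m)))
  (PQ≈Id : (P · Q) ≈ₘ Id) (QP≈Id : (Q · P) ≈ₘ Id) (A≈QCP : A ≈ₘ ((Q · A-v1 m) · P)) where

  V : Set
  V = Vecₙ (suc (m + m))

  f : V → V
  f y = y ⋆ A

  f-⊕ : Additive f
  f-⊕ x y = ⋆-⊕ x y A

  abstract
    Θ : Vec F4 m → Bool → V
    Θ u t = embed u t ⋆ P

    Θ-f : ∀ u t → f (Θ u t) ≡ Θ (ω • u) t
    Θ-f u t = begin
      (embed u t ⋆ P) ⋆ A                       ≡⟨ ⋆-cong (embed u t ⋆ P) A≈QCP ⟩
      (embed u t ⋆ P) ⋆ ((Q · A-v1 m) · P)      ≡⟨ ⋆-· (embed u t ⋆ P) (Q · A-v1 m) P ⟩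
      ((embed u t ⋆ P) ⋆ (Q · A-v1 m)) ⋆ P      ≡⟨ cong (_⋆ P) (⋆-· (embed u t ⋆ P) Q (A-v1 m)) ⟩
      (((embed u t ⋆ P) ⋆ Q) ⋆ A-v1 m) ⋆ P      ≡⟨ cong (λ z → (z ⋆ A-v1 m) ⋆ P) (⋆-inverse P Q PQ≈Id (embed u t)) ⟩
      (embed u t ⋆ A-v1 m) ⋆ P                  ≡⟨ cong (_⋆ P) (embed-A m u t) ⟩
      embed (ω • u) t ⋆ P                       ∎

    Θ-+ : ∀ u v t s → Θ (u +ᵥ v) (t xor s) ≡ Θ u t ⊕ Θ v s
    Θ-+ u v t s = trans (cong (_⋆ P) (embed-+ u v t s)) (⋆-⊕ (embed u t) (embed v s) P)

    Θ-surjective : ∀ y → ∃[ u ] ∃[ t ] Θ u t ≡ y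
    Θ-surjective y = let u , t = split m (y ⋆ Q) in
      u , t , trans (cong (_⋆ P) (embed-split m (y ⋆ Q))) (⋆-inverse Q P QP≈Id y)

    Θ-injective : ∀ {u u′ t t′} → Θ u t ≡ Θ u′ t′ → u ≡ u′ × t ≡ t′
    Θ-injective {u} {u′} {t} {t′} Θ≡Θ = ×-≡,≡←≡ (begin
      (u , t)                         ≡⟨ split-embed u t ⟨
      split m (embed u t)             ≡⟨ cong (split m) (⋆-inverse P Q PQ≈Id (embed u t)) ⟨
      split m (Θ u t ⋆ Q)             ≡⟨ cong (λ z → split m (z ⋆ Q)) Θ≡Θ ⟩
      split m (Θ u′ t′ ⋆ Q)           ≡⟨ cong (split m) (⋆-inverse P Q PQ≈Id (embed u′ t′)) ⟩
      split m (embed u′ t′)           ≡⟨ split-embed u′ t′ ⟩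
      (u′ , t′)                       ∎)

  Θ-𝟎 : Θ 0ᵥ false ≡ 𝟎
  Θ-𝟎 = begin
    Θ 0ᵥ false                           ≡⟨ cong (λ u → Θ u false) (+ᵥ-self 0ᵥ) ⟨
    Θ (0ᵥ +ᵥ 0ᵥ) false                   ≡⟨ Θ-+ 0ᵥ 0ᵥ false false ⟩
    Θ 0ᵥ false ⊕ Θ 0ᵥ false              ≡⟨ ⊕-self (Θ 0ᵥ false) ⟩
    𝟎                                    ∎

  f³ : ∀ y → f (f (f y)) ≡ y
  f³ y with Θ-surjective y
  ... | u , t , refl = begin
    f (f (f (Θ u t)))          ≡⟨ cong (f ∘ f) (Θ-f u t) ⟩
    f (f (Θ (ω • u) t))        ≡⟨ cong f (Θ-f (ω • u) t) ⟩
    f (Θ (ω • ω • u) t)        ≡⟨ Θ-f (ω • ω • u) t ⟩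
    Θ (ω • ω • ω • u) t        ≡⟨ cong (λ w → Θ w t) (ω•³ u) ⟩
    Θ u t                      ∎

  x₀ : V
  x₀ = Θ 0ᵥ true

  x₀≢𝟎 : x₀ ≢ 𝟎
  x₀≢𝟎 x₀≡𝟎 with Θ-injective (trans x₀≡𝟎 (sym Θ-𝟎))
  ... | _ , ()

  f-fixed : ∀ {y} → f y ≡ y → y ≡ 𝟎 ⊎ y ≡ x₀
  f-fixed {y} fy≡y with Θ-surjective y
  ... | u , t , refl with ω•-fixes-only-0ᵥ u (proj₁ (Θ-injective (trans (sym (Θ-f u t)) fy≡y)))
  ... | refl with t
  ...   | false = inj₁ Θ-𝟎
  ...   | true  = inj₂ refl

  φ : Vec F4 m → V
  φ u = Θ u false

  φ⊕Θ0ᵥ : ∀ u t → φ u ⊕ Θ 0ᵥ t ≡ Θ u t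
  φ⊕Θ0ᵥ u t = trans (sym (Θ-+ u 0ᵥ false t)) (cong (λ w → Θ w t) (+ᵥ-identityʳ u))

  φ-comb : ∀ u a b → comb (a ∷ b ∷ []) (φ u ∷ φ (ω • u) ∷ []) ≡ φ ((a , b) • u)
  φ-comb u false false = trans (sym Θ-𝟎) (cong φ (sym (0₄• u)))
  φ-comb u true  false = trans (⊕-identityʳ (φ u)) (cong φ (sym (•-identity u)))
  φ-comb u false true  = ⊕-identityʳ (φ (ω • u))
  φ-comb u true  true  = begin
    φ u ⊕ (φ (ω • u) ⊕ 𝟎)    ≡⟨ cong (φ u ⊕_) (⊕-identityʳ _) ⟩
    φ u ⊕ φ (ω • u)          ≡⟨ Θ-+ u (ω • u) false false ⟨
    φ (u +ᵥ ω • u)           ≡⟨ cong (λ w → φ (w +ᵥ ω • u)) (•-identity u) ⟨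
    φ (1₄ • u +ᵥ ω • u)      ≡⟨ cong φ (•-distribʳ-+₄ 1₄ ω u) ⟩
    φ (ω² • u)               ∎

  X : Sub (suc (m + m))
  X = Span (x₀ ∷ [])

  comb-x₀ : ∀ t → comb (t ∷ []) (x₀ ∷ []) ≡ Θ 0ᵥ t
  comb-x₀ true  = ⊕-identityʳ x₀
  comb-x₀ false = sym Θ-𝟎

  line : Vec F4 m → Sub (suc (m + m))
  line u y = ∃[ w ] (F4span u w × φ w ≡ y)

  block : Vec F4 m → Sub (suc (m + m))
  block u = line u +ˢ X

  block-∋ : ∀ u l t → block u (Θ (l • u) t)
  block-∋ u l t = φ (l • u) , Θ 0ᵥ t , (l • u , (l , refl) , refl) , (t ∷ [] , comb-x₀ t) , φ⊕Θ0ᵥ (l • u) t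

  block-elements : ∀ u {y} → block u y → ∃[ l ] ∃[ t ] Θ (l • u) t ≡ y
  block-elements u (_ , _ , (_ , (l , refl) , refl) , (t ∷ [] , refl) , refl) =
    l , t , sym (trans (cong (φ (l • u) ⊕_) (comb-x₀ t)) (φ⊕Θ0ᵥ (l • u) t))

  line⊆block : ∀ u → line u ⊆ block u
  line⊆block u y (_ , (l , refl) , refl) = block-∋ u l false

  φ∈line : ∀ u → line u (φ u)
  φ∈line u = u , (1₄ , •-identity u) , refl

  line-f : ∀ u {y} → line u y → line u (f y)
  line-f u (_ , (l , refl) , refl) = (ω *₄ l) • u , (ω *₄ l , refl) , sym (trans (Θ-f (l • u) false) (cong φ (•-assoc ω l u)))

  block-f : ∀ u {y} → block u y → block u (f y)
  block-f u y∈block with block-elements u y∈block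
  ... | l , t , refl = subst (block u) (sym (trans (Θ-f (l • u) t) (cong (λ w → Θ w t) (•-assoc ω l u))))
                             (block-∋ u (ω *₄ l) t)

  img³ : (S : Sub (suc (m + m))) → img A (img A (img A S)) ≐ S
  img³ S y = mk⇔ (λ { (_ , (_ , (x , x∈S , refl) , refl) , refl) → subst S (sym (f³ x)) x∈S })
                 (λ y∈S → f (f y) , (f y , (y , y∈S , refl) , refl) , f³ y)

  img-block : ∀ u → img A (block u) ≐ block u
  img-block u y = mk⇔ (λ { (x , x∈block , refl) → block-f u x∈block })
                      (λ y∈block → f (f y) , block-f u (block-f u y∈block) , f³ y)

  block-type1 : ∀ {u} → u ≢ 0ᵥ → FixedType1 A (block u)
  block-type1 {u} u≢0 = img-block u , φ u , line⊆block u (φ u) (φ∈line u) ,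
    λ fφu≡φu → u≢0 (ω•-fixes-only-0ᵥ u (proj₁ (Θ-injective (trans (sym (Θ-f u false)) fφu≡φu))))

  line-dim : ∀ {u} → u ≢ 0ᵥ → IsSubspaceOfDim 2 (line u)
  line-dim {u} u≢0 = φ u ∷ φ (ω • u) ∷ [] , indep , λ y → mk⇔
    (λ { (_ , ((a , b) , refl) , refl) → a ∷ b ∷ [] , φ-comb u a b })
    (λ { (a ∷ b ∷ [] , refl) → (a , b) • u , ((a , b) , refl) , sym (φ-comb u a b) })
    where
    indep : LinIndep (φ u ∷ φ (ω • u) ∷ [])
    indep (a ∷ b ∷ []) ab↦𝟎 with •≡0ᵥ⇒≡0₄ (a , b) u u≢0 (proj₁ (Θ-injective (trans (sym (φ-comb u a b)) (trans ab↦𝟎 (sym Θ-𝟎)))))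
    ... | refl = refl

  block-dim : ∀ {u} → u ≢ 0ᵥ → IsSubspaceOfDim 3 (block u)
  block-dim {u} u≢0 = basis , indep , λ y → mk⇔
    (λ y∈block → let (a , b) , t , ↦y = block-elements u y∈block in a ∷ b ∷ t ∷ [] , trans (comb-basis a b t) ↦y)
    (λ { (a ∷ b ∷ t ∷ [] , refl) → subst (block u) (sym (comb-basis a b t)) (block-∋ u (a , b) t) })
    where
    basis : Vec V 3
    basis = φ u ∷ φ (ω • u) ∷ x₀ ∷ []
    comb-basis : ∀ a b t → comb (a ∷ b ∷ t ∷ []) basis ≡ Θ ((a , b) • u) t
    comb-basis a b t = begin
      comb (a ∷ b ∷ t ∷ []) basis                                ≡⟨ comb-++ (a ∷ b ∷ []) (t ∷ []) (φ u ∷ φ (ω • u) ∷ []) (x₀ ∷ []) ⟩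
      comb (a ∷ b ∷ []) (φ u ∷ φ (ω • u) ∷ []) ⊕ comb (t ∷ []) (x₀ ∷ []) ≡⟨ cong₂ _⊕_ (φ-comb u a b) (comb-x₀ t) ⟩
      φ ((a , b) • u) ⊕ Θ 0ᵥ t                                   ≡⟨ φ⊕Θ0ᵥ ((a , b) • u) t ⟩
      Θ ((a , b) • u) t                                          ∎
    indep : LinIndep basis
    indep (a ∷ b ∷ t ∷ []) abt↦𝟎 with Θ-injective (trans (sym (comb-basis a b t)) (trans abt↦𝟎 (sym Θ-𝟎)))
    ... | ab•u≡0 , refl with •≡0ᵥ⇒≡0₄ (a , b) u u≢0 ab•u≡0
    ... | refl = refl

  block-≐⇒∝ : ∀ u u′ → block u ≐ block u′ → u ∝ u′
  block-≐⇒∝ u u′ u≐u′ with block-elements u′ (Equivalence.to (u≐u′ (φ u)) (line⊆block u (φ u) (φ∈line u)))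
  ... | l , t , Θ≡φu = l , proj₁ (Θ-injective Θ≡φu)

  block-scale : ∀ {l} u → l ≢ 0₄ → block u ≐ block (l • u)
  block-scale {l} u l≢0 y = mk⇔
    (λ y∈block → case block-elements u y∈block of λ where
      (k , t , refl) → subst (λ w → block (l • u) (Θ w t)) (rescale k) (block-∋ (l • u) (k *₄ l ⁻¹₄) t))
    (λ y∈block → case block-elements (l • u) y∈block of λ where
      (k , t , refl) → subst (λ w → block u (Θ w t)) (sym (•-assoc k l u)) (block-∋ u (k *₄ l) t))
    where
    rescale : ∀ k → (k *₄ l ⁻¹₄) • l • u ≡ k • u
    rescale k = begin
      (k *₄ l ⁻¹₄) • l • u      ≡⟨ •-assoc (k *₄ l ⁻¹₄) l u ⟩
      ((k *₄ l ⁻¹₄) *₄ l) • u   ≡⟨ cong (_• u) (*₄-assoc k (l ⁻¹₄) l) ⟨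
      (k *₄ (l ⁻¹₄ *₄ l)) • u   ≡⟨ cong (λ a → (k *₄ a) • u) (*₄-inverseˡ l l≢0) ⟩
      (k *₄ 1₄) • u             ≡⟨ cong (_• u) (*₄-identityʳ k) ⟩
      k • u                     ∎

  W : Sub (suc (m + m))
  W y = ∃[ u ] φ u ≡ y

  φ-+ : ∀ u v → φ (u +ᵥ v) ≡ φ u ⊕ φ v
  φ-+ u v = Θ-+ u v false false

  φ-injective : ∀ u v → φ u ≡ φ v → u ≡ v
  φ-injective u v φu≡φv = proj₁ (Θ-injective φu≡φv)

  W-dim : IsSubspaceOfDim (m + m) W
  W-dim = dim-resp image≐W (image-dim (φ ∘ pairUp) φ∘pairUp-⊕ φ∘pairUp-injective)
    where
    φ∘pairUp-⊕ : Additive (φ ∘ pairUp)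
    φ∘pairUp-⊕ c d = trans (cong φ (pairUp-⊕ c d)) (φ-+ (pairUp c) (pairUp d))
    φ∘pairUp-injective : ∀ c d → φ (pairUp c) ≡ φ (pairUp d) → c ≡ d
    φ∘pairUp-injective c d = pairUp-injective c d ∘ φ-injective (pairUp c) (pairUp d)
    image≐W : (λ y → ∃[ c ] φ (pairUp c) ≡ y) ≐ W
    image≐W y = mk⇔ (λ (c , φc≡y) → pairUp c , φc≡y)
                    (λ (u , φu≡y) → let c , c↦u = pairUp-surjective u in c , trans (cong φ c↦u) φu≡y)

  X-dim : IsSubspaceOfDim 1 X
  X-dim = x₀ ∷ [] , indep , λ y → mk⇔ id id
    where
    indep : LinIndep (x₀ ∷ [])
    indep (true ∷ [])  x₀≡𝟎 = contradiction (trans (sym (⊕-identityʳ x₀)) x₀≡𝟎) x₀≢𝟎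
    indep (false ∷ []) _    = refl

  W+X≐V : ∀ y → (W +ˢ X) y
  W+X≐V y = let u , t , Θut≡y = Θ-surjective y in
    φ u , Θ 0ᵥ t , (u , refl) , (t ∷ [] , comb-x₀ t) , trans (φ⊕Θ0ᵥ u t) Θut≡y

  𝓛 : Sub (suc (m + m)) → Set
  𝓛 L = ∃[ u ] (u ≢ 0ᵥ × L ≐ line u)

  𝓛-desarguesian : IsDesarguesianSpread m W 𝓛
  𝓛-desarguesian = φ , φ-+ , φ-injective , (λ y → mk⇔ id id) , (λ L → mk⇔ id id)

  moved⇒v+ωv≢0 : ∀ v t → f (Θ v t) ≢ Θ v t → v +ᵥ ω • v ≢ 0ᵥ
  moved⇒v+ωv≢0 v t fx≢x u≡0 = fx≢x (trans (Θ-f v t) (cong (λ w → Θ w t) (sym (+ᵥ≡0ᵥ⇒≡ v (ω • v) u≡0))))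

  φ[v+ωv]≡x⊕fx : ∀ v t → φ (v +ᵥ ω • v) ≡ Θ v t ⊕ f (Θ v t)
  φ[v+ωv]≡x⊕fx v t = begin
    Θ (v +ᵥ ω • v) false           ≡⟨ cong (Θ (v +ᵥ ω • v)) (xor-same t) ⟨
    Θ (v +ᵥ ω • v) (t xor t)       ≡⟨ Θ-+ v (ω • v) t t ⟩
    Θ v t ⊕ Θ (ω • v) t            ≡⟨ cong (Θ v t ⊕_) (Θ-f v t) ⟨
    Θ v t ⊕ f (Θ v t)              ∎

  module Design-with-automorphism (D : Design (suc (m + m))) (sts : IsSTS₂ (suc (m + m)) D)
                                  (aut : IsAutomorphism A D) where

    D-dim : ∀ {B} → B ∈ᴰ D → IsSubspaceOfDim 3 B
    D-dim B∈D = let B′-dim , B′≐B = All.lookupAny (proj₁ sts) B∈D in dim-resp B′≐B B′-dim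

    block-through : ∀ {T} → IsSubspaceOfDim 2 T → Σ (Sub (suc (m + m))) λ B → B ∈ᴰ D × T ⊆ B
    block-through {T} T-dim = proj₁ (proj₂ (proj₂ sts) T T-dim)

    unique-block : ∀ {T} → IsSubspaceOfDim 2 T → ∀ {B B′} → B ∈ᴰ D → B′ ∈ᴰ D → T ⊆ B → T ⊆ B′ → B ≐ B′
    unique-block {T} T-dim = proj₂ (proj₂ (proj₂ sts) T T-dim) _ _

    fixed-block-∋-x₀ : ∀ {B} → B ∈ᴰ D → B ≐ img A B → B x₀
    fixed-block-∋-x₀ {B} B∈D B≐AB =
      let y , y∈B , y≢𝟎 , fy≡y = invariant-3-space-has-fixed-vector f f-⊕ f³ (D-dim B∈D) f-closed
      in [ (λ y≡𝟎 → contradiction y≡𝟎 y≢𝟎) , (λ y≡x₀ → subst B y≡x₀ y∈B) ]′ (f-fixed fy≡y)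
      where
      f-closed : ∀ {y} → B y → B (f y)
      f-closed {y} y∈B = Equivalence.from (B≐AB (f y)) (y , y∈B , refl)

    block-∈ᴰ : ∀ {u} → u ≢ 0ᵥ → block u ∈ᴰ D
    block-∈ᴰ {u} u≢0 with block-through (line-dim u≢0)
    ... | B , B∈D , line⊆B = ∈ᴰ-resp (≐-sym (dim3-⊆⇒≐ (block-dim u≢0) (D-dim B∈D) block⊆B)) B∈D
      where
      -- line u is f-invariant, so f fixes the unique block through it
      line⊆AB : line u ⊆ img A B
      line⊆AB y y∈line = f (f y) , line⊆B _ (line-f u (line-f u y∈line)) , f³ y
      x₀∈B : B x₀
      x₀∈B = fixed-block-∋-x₀ B∈D (unique-block (line-dim u≢0) B∈D (proj₁ (proj₂ aut) B B∈D) line⊆B line⊆AB)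
      block⊆B : block u ⊆ B
      block⊆B _ (s , _ , s∈line , (c , refl) , refl) =
        subspace-⊕ (D-dim B∈D) (line⊆B s s∈line) (subspace-comb (D-dim B∈D) (x₀∈B ∷ []) c)

    -- If f moves x ∈ B, then with x = Θ v t the vectors φ u = x + f x and f (φ u), u = v + ω v,
    -- lie in B, so B contains the line of u.
    fixedType1⇒block : ∀ {B} → B ∈ᴰ D → FixedType1 A B → ∃[ u ] (u ≢ 0ᵥ × B ≐ block u)
    fixedType1⇒block {B} B∈D (AB≐B , x , x∈B , fx≢x) = from-preimage (Θ-surjective x) x∈B fx≢x
      where
      f-closed : ∀ {y} → B y → B (f y)
      f-closed {y} y∈B = Equivalence.to (AB≐B (f y)) (y , y∈B , refl)
      line⊆B : ∀ v t → B (Θ v t) → line (v +ᵥ ω • v) ⊆ B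
      line⊆B v t x∈B _ (_ , ((a , b) , refl) , refl) =
        subst B (φ-comb u a b) (subspace-comb (D-dim B∈D) (φu∈B ∷ subst B (Θ-f u false) (f-closed φu∈B) ∷ []) (a ∷ b ∷ []))
        where
        u = v +ᵥ ω • v
        φu∈B : B (φ u)
        φu∈B = subst B (sym (φ[v+ωv]≡x⊕fx v t)) (subspace-⊕ (D-dim B∈D) x∈B (f-closed x∈B))
      from-preimage : ∀ {x} → (∃[ v ] ∃[ t ] Θ v t ≡ x) → B x → f x ≢ x → ∃[ u ] (u ≢ 0ᵥ × B ≐ block u)
      from-preimage (v , t , refl) x∈B fx≢x =
        let u≢0 = moved⇒v+ωv≢0 v t fx≢x
        in v +ᵥ ω • v , u≢0 , unique-block (line-dim u≢0) B∈D (block-∈ᴰ u≢0) (line⊆B v t x∈B) (line⊆block _)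

    non-type1-not-fixed : ∀ {B} → B ∈ᴰ D → ¬ FixedType1 A B → ¬ (B ≐ img A B)
    non-type1-not-fixed {B} B∈D ¬type1 B≐AB = no-3-space-within-pair (D-dim B∈D) x₀ (f-fixed ∘ fixed)
      where
      fixed : ∀ {y} → B y → f y ≡ y
      fixed {y} y∈B = case f y ≟ⱽ y of λ where
        (yes fy≡y) → fy≡y
        (no fy≢y)  → contradiction (≐-sym B≐AB , y , y∈B , fy≢y) ¬type1

    orbit-length-3 : ∀ {B} → B ∈ᴰ D → ¬ FixedType1 A B →
      ¬ (B ≐ img A B) × ¬ (img A B ≐ img A (img A B)) × ¬ (B ≐ img A (img A B))
    orbit-length-3 {B} B∈D ¬type1 =
      ¬B≐AB ,
      (λ AB≐A²B → ¬B≐AB (≐-trans (≐-sym (img³ B)) (≐-trans (img-resp A (img-resp A AB≐A²B)) (img³ (img A B))))) ,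
      (λ B≐A²B → ¬B≐AB (≐-sym (≐-trans (img-resp A B≐A²B) (img³ B))))
      where
      ¬B≐AB = non-type1-not-fixed B∈D ¬type1

    fixedBlocks : List (Sub (suc (m + m)))
    fixedBlocks = List.map block (projectivePoints m)

    fixedBlocks-distinct : AllPairs (λ B B′ → ¬ (B ≐ B′)) fixedBlocks
    fixedBlocks-distinct =
      AllPairs.map⁺ (AllPairs.map (λ ¬u∝u′ u≐u′ → ¬u∝u′ (block-≐⇒∝ _ _ u≐u′)) (projectivePoints-distinct m))

    fixedBlocks-type1 : All (λ B → B ∈ᴰ D × FixedType1 A B) fixedBlocks
    fixedBlocks-type1 = All.map⁺ (All.map (λ u≢0 → block-∈ᴰ u≢0 , block-type1 u≢0) (projectivePoints-nonzero m))

    fixedBlocks-complete : ∀ B → Any (λ B′ → B′ ≡ B) D → FixedType1 A B → B ∈ᴰ fixedBlocks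
    fixedBlocks-complete B B∈D type1 =
      let u , u≢0 , B≐block = fixedType1⇒block (∈⇒∈ᴰ B∈D) type1
          l , u₀ , l≢0 , u₀∈ , u≡lu₀ = projectivePoints-complete u u≢0
      in Any.map⁺ (Any.map (λ { refl → ≐-trans (block-scale u₀ l≢0) (subst (λ w → block w ≐ B) u≡lu₀ (≐-sym B≐block)) }) u₀∈)

    length-fixedBlocks : length fixedBlocks ≡ (2 ^ (m + m) ∸ 1) / 3
    length-fixedBlocks = trans (length-map block (projectivePoints m)) (length-projectivePoints m)

    fixedType1⇔line+X : ∀ B → (B ∈ᴰ D × FixedType1 A B) ⇔ (Σ (Sub (suc (m + m))) λ L → 𝓛 L × B ≐ (L +ˢ X))
    fixedType1⇔line+X B = mk⇔
      (λ (B∈D , type1) → let u , u≢0 , B≐block = fixedType1⇒block B∈D type1 in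
        line u , (u , u≢0 , ≐-refl (line u)) , B≐block)
      (λ (L , (u , u≢0 , L≐line) , B≐L+X) → let B≐block = ≐-trans B≐L+X (+ˢ-respˡ L≐line) in
        ∈ᴰ-resp (≐-sym B≐block) (block-∈ᴰ u≢0) , fixedType1-resp A (≐-sym B≐block) (block-type1 u≢0))

lemma11 : (m : ℕ) (D : Design (suc (m + m))) (A : Mat (suc (m + m))) →
  IsSTS₂ (suc (m + m)) D → IsAutomorphism A D → Conjugate A (A-v1 m) →
  (Σ (List (Sub (suc (m + m)))) λ F →
     AllPairs (λ B B′ → ¬ (B ≐ B′)) F ×
     All (λ B → B ∈ᴰ D × FixedType1 A B) F ×
     (∀ B → Any (λ B′ → B′ ≡ B) D → FixedType1 A B → B ∈ᴰ F) ×
     length F ≡ (2 ^ (m + m) ∸ 1) / 3) ×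
  (∀ B → Any (λ B′ → B′ ≡ B) D → ¬ FixedType1 A B →
     ¬ (B ≐ img A B) × ¬ (img A B ≐ img A (img A B)) × ¬ (B ≐ img A (img A B))) ×
  (Σ (Sub (suc (m + m))) λ W → Σ (Sub (suc (m + m))) λ X →
   Σ (Sub (suc (m + m)) → Set) λ 𝓛 →
     IsSubspaceOfDim (m + m) W × IsSubspaceOfDim 1 X ×
     (∀ y → (W +ˢ X) y) ×
     IsDesarguesianSpread m W 𝓛 ×
     (∀ B → (B ∈ᴰ D × FixedType1 A B) ⇔ (Σ (Sub (suc (m + m))) λ L → 𝓛 L × B ≐ (L +ˢ X))))
lemma11 m D A sts aut (P , Q , PQ≈Id , QP≈Id , A≈QCP) =
  (fixedBlocks , fixedBlocks-distinct , fixedBlocks-type1 , fixedBlocks-complete , length-fixedBlocks) ,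
  (λ B → orbit-length-3 ∘ ∈⇒∈ᴰ) ,
  (W , X , 𝓛 , W-dim , X-dim , W+X≐V , 𝓛-desarguesian , fixedType1⇔line+X)
  where
  open TypeA-v1 m A P Q PQ≈Id QP≈Id A≈QCP
  open Design-with-automorphism D sts aut
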